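{- Let $T$ be a rooted ordered edge-labeled tree and $Q$ an unrooted ordered edge-labeled tree. Then (1) $\mathrm{sim}(T, Q[i,j+1)) \le \mathrm{sim}(T, Q[i,j)) + 2$ for all $i \le j$ with $j-i+1 \le 2|E(Q)|$ (and $j+1\le 4|E(Q)|$); (2) $\mathrm{sim}(T, Q[i-1,j)) \le \mathrm{sim}(T, Q[i,j)) + 2$ for all $i \le j$ with $j-i+1 \le 2|E(Q)|$ (and $i-1 \ge 1$).
   Context: Rooted ordered trees have a left-to-right order of children at each vertex; unrooted ordered trees have a cyclic order of neighbors at each vertex. For rooted trees $T_1,T_2$, $\mathrm{ed}(T_1,T_2)$ is the minimum number of operations (relabeling an edge, or contracting an edge $pu$ with $p$ parent of $u$, the children of $u$ replacing $u$ in $p$'s child list in order) applied to $T_1$ and $T_2$ to make them identical, and $\mathrm{sim}(T_1,T_2) = |E(T_1)| + |E(T_2)| - \mathrm{ed}(T_1,T_2)$. For the unrooted tree $Q$, consider the walk starting at an arbitrary edge that goes twice through the Euler tour of $Q$ (visiting neighbors according to their cyclic order); $Q(k)$ denotes the $k$-th edge of this walk, $k \in \{1,\dots,4|E(Q)|\}$, so each edge appears exactly 4 times. For $1 \le l \le r \le 4|E(Q)|$ with $r - l \le 2|E(Q)|$, the segment $Q[l,r)$ is the tree obtained from $Q$ by contracting every edge that occurs fewer than 2 times among $Q(l),\dots,Q(r-1)$; it is viewed as a rooted ordered tree whose rooting is determined by the first non-contracted edge appearing in $Q(l),\dots,Q(r-1)$. -}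

module Defs where

open import Data.Nat using (ℕ; zero; suc; _+_; _∸_; _≤_; _≡ᵇ_; _≤ᵇ_)
open import Data.Bool using (Bool; true; false; if_then_else_)
open import Data.List using (List; []; _∷_; _++_; [_]; take; drop)
open import Data.Maybe using (Maybe; just; nothing; _<∣>_)
open import Data.Product using (Σ; _×_; _,_; proj₁; proj₂)
open import Relation.Binary.PropositionalEquality using (_≡_)

-- Rooted ordered edge-labelled trees.
-- A vertex is given by the ordered list of its child edges; each child
-- edge carries its annotation (label) and the subtree hanging below it.

data Tree (A : Set) : Set where
  node : List (A × Tree A) → Tree A

Forest : Set → Set
Forest A = List (A × Tree A)

-- number of edges
sizeF : {A : Set} → Forest A → ℕ
sizeF [] = 0
sizeF ((a , node cs) ∷ f) = suc (sizeF cs + sizeF f)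

size : {A : Set} → Tree A → ℕ
size (node f) = sizeF f

mapF : {A B : Set} → (A → B) → Forest A → Forest B
mapF g [] = []
mapF g ((a , node cs) ∷ f) = (g a , node (mapF g cs)) ∷ mapF g f

mapT : {A B : Set} → (A → B) → Tree A → Tree B
mapT g (node f) = node (mapF g f)

-- Edit operations on a rooted ordered tree (one operation = one step):
--  * relabel an edge (to an arbitrary label),
--  * contract an edge pu (p parent of u): the children of u replace u,
--    in order, in p's child list.

data StepF {L : Set} : Forest L → Forest L → Set where
  relabel  : ∀ {l l' t f} → StepF ((l , t) ∷ f) ((l' , t) ∷ f)
  contract : ∀ {l cs f} → StepF ((l , node cs) ∷ f) (cs ++ f)
  inside   : ∀ {l cs cs' f} → StepF cs cs' →
             StepF ((l , node cs) ∷ f) ((l , node cs') ∷ f)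
  later    : ∀ {x f f'} → StepF f f' → StepF (x ∷ f) (x ∷ f')

data Step {L : Set} : Tree L → Tree L → Set where
  step : ∀ {f f'} → StepF f f' → Step (node f) (node f')

data Steps {L : Set} : ℕ → Tree L → Tree L → Set where
  done : ∀ {t} → Steps 0 t t
  more : ∀ {n t t' t''} → Step t t' → Steps n t' t'' → Steps (suc n) t t''

IsEd : {L : Set} → Tree L → Tree L → ℕ → Set
IsEd {L} T₁ T₂ d =
  (Σ ℕ λ a → Σ ℕ λ b → Σ (Tree L) λ S →
     Steps a T₁ S × Steps b T₂ S × a + b ≡ d)
  × (∀ a b (S : Tree L) → Steps a T₁ S → Steps b T₂ S → d ≤ a + b)

IsSim : {L : Set} → Tree L → Tree L → ℕ → Set
IsSim T₁ T₂ s = Σ ℕ λ d → IsEd T₁ T₂ d × s ≡ (size T₁ + size T₂) ∸ d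

-- Unrooted ordered trees with a chosen starting (directed) edge of the
-- Euler walk are represented by a rooted ordered tree Q: the root is the
-- tail of the starting edge, the root's child list is the cyclic order at
-- the root cut at the starting edge, and at any other vertex with parent
-- edge p and children c₁…c_k the cyclic order is (p, c₁, …, c_k).

-- edge identities: preorder numbering
numF : {L : Set} → ℕ → Forest L → Forest (ℕ × L) × ℕ
numF n [] = [] , n
numF n ((l , node cs) ∷ f) with numF (suc n) cs
... | cs' , n' with numF n' f
... | f' , n'' = ((n , l) , node cs') ∷ f' , n''

numT : {L : Set} → Tree L → Tree (ℕ × L)
numT (node f) = node (proj₁ (numF 0 f))

-- directed traversals of edges (darts)
data Dir : Set where
  down up : Dir

tourF : {A : Set} → Forest A → List (Dir × A)
tourF [] = []
tourF ((a , node cs) ∷ f) = (down , a) ∷ (tourF cs ++ ((up , a) ∷ tourF f))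

tourT : {A : Set} → Tree A → List (Dir × A)
tourT (node f) = tourF f

-- the walk going twice through the Euler tour; Q(k) is its k-th entry
walk : {L : Set} → Tree L → List (Dir × (ℕ × L))
walk Q = tourT (numT Q) ++ tourT (numT Q)

-- the entries Q(l), …, Q(r-1)
window : {L : Set} → Tree L → ℕ → ℕ → List (Dir × (ℕ × L))
window Q l r = take (r ∸ l) (drop (l ∸ 1) (walk Q))

count : {L : Set} → ℕ → List (Dir × (ℕ × L)) → ℕ
count e [] = 0
count e ((_ , (e' , _)) ∷ w) = if e ≡ᵇ e' then suc (count e w) else count e w

contractF : {L : Set} → (ℕ → Bool) → Forest (ℕ × L) → Forest (ℕ × L)
contractF keep [] = []
contractF keep ((a , node cs) ∷ f) =
  if keep (proj₁ a) then (a , node (contractF keep cs)) ∷ contractF keep f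
                    else contractF keep cs ++ contractF keep f

firstKept : {L : Set} → (ℕ → Bool) → List (Dir × (ℕ × L)) → Maybe (Dir × (ℕ × L))
firstKept keep [] = nothing
firstKept keep ((d , a) ∷ w) = if keep (proj₁ a) then just (d , a) else firstKept keep w

-- Re-rooting an (ordered) tree at a dart, via a zipper.
-- A frame (ls , a , rs) describes a parent vertex w whose child list is
-- ls ++ [(a , current)] ++ rs.
Frame : Set → Set
Frame A = Forest A × A × Forest A

edgeOf : {A : Set} → Frame A → A
edgeOf (_ , a , _) = a

-- the child list of the parent w, seen as a subtree entered from below
-- through the edge of the frame (cyclic order at w continued after it)
upW : {A : Set} → Frame A → List (Frame A) → Forest A
upW (ls , a , rs) [] = rs ++ ls
upW (ls , a , rs) (f' ∷ fs) = rs ++ ((edgeOf f' , node (upW f' fs)) ∷ ls)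

parentPart : {A : Set} → List (Frame A) → Forest A
parentPart [] = []
parentPart (f ∷ fs) = [ (edgeOf f , node (upW f fs)) ]

-- locate the edge with a given id: context of its parent endpoint,
-- left siblings, the edge, its subtree, right siblings
findF : {L : Set} → ℕ → List (Frame (ℕ × L)) → Forest (ℕ × L) → Forest (ℕ × L) →
        Maybe (List (Frame (ℕ × L)) × Forest (ℕ × L) × (ℕ × L) × Tree (ℕ × L) × Forest (ℕ × L))
findF e ctx pre [] = nothing
findF e ctx pre ((a , node cs) ∷ rs) =
  if proj₁ a ≡ᵇ e then just (ctx , pre , a , node cs , rs)
  else (findF e ((pre , a , rs) ∷ ctx) [] cs <∣> findF e ctx (pre ++ [ (a , node cs) ]) rs)

-- root the tree at the tail of the dart, the dart's edge being the first
-- child edge of the new root (the rest following the cyclic order)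
reroot : {L : Set} → Dir × (ℕ × L) → Tree (ℕ × L) → Tree (ℕ × L)
reroot (d , (e , _)) (node f) with findF e [] [] f
... | nothing = node f
reroot (down , _) (node f) | just (ctx , pre , a , t , rs) =
  node ((a , t) ∷ (rs ++ (parentPart ctx ++ pre)))
reroot (up , _) (node f) | just (ctx , pre , a , node cs , rs) =
  node ((a , node (upW (pre , a , rs) ctx)) ∷ cs)

segment : {L : Set} → Tree L → ℕ → ℕ → Tree L
segment Q l r with numT Q
... | node f = mapT proj₂ (result (firstKept keep w))
  where
  w = window Q l r
  keep : ℕ → Bool
  keep e = 2 ≤ᵇ count e w
  Qc = node (contractF keep f)
  result : Maybe (Dir × (ℕ × _)) → Tree (ℕ × _)
  result nothing = node []
  result (just x) = reroot x Qc

-- A segment Q[l, r) keeps exactly the edges both of whose darts lie in the window Q(l), …, Q(r-1).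
-- Number the edges of Q and let W be its tour of darts; a window of length at most |W| is a prefix
-- of a rotation S of W, and the edge tour of the segment is S with the darts of unkept edges
-- deleted.  Because every edge has exactly two darts, a tree with distinct edge numbers is
-- determined by its edge tour, and deleting both occurrences of one edge from the tour amounts to
-- contracting that edge.  Enlarging the window by one dart adds at most one kept edge, so the
-- smaller segment is the larger one or one contraction of it.  Finally a contraction removes one
-- edge and raises ed(T, ·) by at most one, so sim(T, ·) drops by at most two.

module Submission where

open import Data.Bool using (Bool; true; false; if_then_else_; not; _∧_)
open import Data.Bool.Properties using (T-≡; ¬-not; ∧-zeroʳ; ∧-identityʳ)
open import Data.Empty using (⊥-elim)
open import Data.List using (List; []; _∷_; _++_; [_]; map; filterᵇ; length; take; drop)
open import Data.List.Properties
  using (++-assoc; ++-identityʳ; ++-monoid; ∷-injective; map-++; length-++; filter-++;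
         take++drop≡id; take-take; take-[]; length-drop)
open import Data.Maybe using (Maybe; just; nothing)
open import Data.Nat using (ℕ; zero; suc; _+_; _*_; _∸_; _≤_; _<_; z≤n; s≤s; _≡ᵇ_; _≤ᵇ_)
open import Data.Nat.Properties
open import Data.Nat.Tactic.RingSolver using (solve-∀)
open import Data.Product using (Σ; _×_; _,_; proj₁; proj₂)
open import Data.Sum using (_⊎_; inj₁; inj₂)
open import Function using (_∘_; case_of_; Equivalence)
open import Relation.Binary.PropositionalEquality
  using (_≡_; _≢_; refl; sym; trans; cong; cong₂; subst; subst₂; module ≡-Reasoning)
open import Relation.Nullary using (yes; no)
open import Relation.Nullary.Decidable using (T?)
open import Tactic.MonoidSolver using (solve)

open import Defs

m+n∸o≤m∸o+n : ∀ m n o → m + n ∸ o ≤ m ∸ o + n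
m+n∸o≤m∸o+n m n o = m≤n+o⇒m∸n≤o (m + n) o (begin
  m + n             ≤⟨ +-monoˡ-≤ n (m≤n+m∸n m o) ⟩
  o + (m ∸ o) + n   ≡⟨ +-assoc o (m ∸ o) n ⟩
  o + (m ∸ o + n)   ∎)
  where open ≤-Reasoning

≡ᵇ-refl : ∀ n → (n ≡ᵇ n) ≡ true
≡ᵇ-refl n = Equivalence.to T-≡ (≡⇒≡ᵇ n n refl)

≢⇒≡ᵇ≡false : ∀ m n → m ≢ n → (m ≡ᵇ n) ≡ false
≢⇒≡ᵇ≡false m n m≢n = ¬-not (m≢n ∘ ≡ᵇ⇒≡ m n ∘ Equivalence.from T-≡)

[m+1]∸n≡1+[m∸n] : ∀ {n} m → n ≤ m → (m + 1) ∸ n ≡ suc (m ∸ n)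
[m+1]∸n≡1+[m∸n] {n} m n≤m = trans (+-∸-comm 1 n≤m) (+-comm (m ∸ n) 1)

m<n⇒n∸m≡1+[n∸1+m] : ∀ {m n} → m < n → n ∸ m ≡ suc (n ∸ suc m)
m<n⇒n∸m≡1+[n∸1+m] {zero}  {suc n} _         = refl
m<n⇒n∸m≡1+[n∸1+m] {suc m} {suc n} (s≤s m<n) = m<n⇒n∸m≡1+[n∸1+m] m<n


-- Lists: counting, filtering, rotations

module _ {A : Set} where

  countᵇ : (A → Bool) → List A → ℕ
  countᵇ p []       = 0
  countᵇ p (x ∷ xs) = if p x then suc (countᵇ p xs) else countᵇ p xs

  module _ (p : A → Bool) where

    filterᵇ-accept : ∀ {x} xs → p x ≡ true → filterᵇ p (x ∷ xs) ≡ x ∷ filterᵇ p xs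
    filterᵇ-accept xs px rewrite px = refl

    filterᵇ-reject : ∀ {x} xs → p x ≡ false → filterᵇ p (x ∷ xs) ≡ filterᵇ p xs
    filterᵇ-reject xs px rewrite px = refl

    countᵇ-accept : ∀ {x} xs → p x ≡ true → countᵇ p (x ∷ xs) ≡ suc (countᵇ p xs)
    countᵇ-accept xs px rewrite px = refl

    countᵇ-reject : ∀ {x} xs → p x ≡ false → countᵇ p (x ∷ xs) ≡ countᵇ p xs
    countᵇ-reject xs px rewrite px = refl

    countᵇ-++ : ∀ xs ys → countᵇ p (xs ++ ys) ≡ countᵇ p xs + countᵇ p ys
    countᵇ-++ []       ys = refl
    countᵇ-++ (x ∷ xs) ys with p x
    ... | true  = cong suc (countᵇ-++ xs ys)
    ... | false = countᵇ-++ xs ys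

    countᵇ-filterᵇ : ∀ q xs → countᵇ p (filterᵇ q xs) ≤ countᵇ p xs
    countᵇ-filterᵇ q []       = z≤n
    countᵇ-filterᵇ q (x ∷ xs) with q x
    ... | true with p x
    ...   | true  = s≤s (countᵇ-filterᵇ q xs)
    ...   | false = countᵇ-filterᵇ q xs
    countᵇ-filterᵇ q (x ∷ xs) | false with p x
    ...   | true  = m≤n⇒m≤1+n (countᵇ-filterᵇ q xs)
    ...   | false = countᵇ-filterᵇ q xs

    filterᵇ-not-countᵇ≡0 : ∀ xs → countᵇ p xs ≡ 0 → filterᵇ (not ∘ p) xs ≡ xs
    filterᵇ-not-countᵇ≡0 []       _ = refl
    filterᵇ-not-countᵇ≡0 (x ∷ xs) c with p x
    ... | false = cong (x ∷_) (filterᵇ-not-countᵇ≡0 xs c)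

    filterᵇ-all-false : ∀ xs → (∀ x → p x ≡ false) → filterᵇ p xs ≡ []
    filterᵇ-all-false []       _ = refl
    filterᵇ-all-false (x ∷ xs) f = trans (filterᵇ-reject xs (f x)) (filterᵇ-all-false xs f)

    countᵇ-++-∷≢0 : ∀ xs {y} ys → p y ≡ true → countᵇ p (xs ++ y ∷ ys) ≢ 0
    countᵇ-++-∷≢0 xs {y} ys py c = 1+n≢0 (begin
      suc (countᵇ p xs + countᵇ p ys)    ≡⟨ +-suc (countᵇ p xs) (countᵇ p ys) ⟨
      countᵇ p xs + suc (countᵇ p ys)    ≡⟨ cong (countᵇ p xs +_) (countᵇ-accept ys py) ⟨
      countᵇ p xs + countᵇ p (y ∷ ys)    ≡⟨ countᵇ-++ xs (y ∷ ys) ⟨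
      countᵇ p (xs ++ y ∷ ys)            ≡⟨ c ⟩
      0                                  ∎)
      where open ≡-Reasoning

    split-at-first : ∀ xs xs' ys ys' {y y'} → xs ++ y ∷ ys ≡ xs' ++ y' ∷ ys' →
      p y ≡ true → countᵇ p xs' ≡ 0 →
      (xs ≡ xs' × y ≡ y' × ys ≡ ys') ⊎ (Σ (List A) λ zs → xs ≡ xs' ++ y' ∷ zs × ys' ≡ zs ++ y ∷ ys)
    split-at-first []       []        ys ys' refl py c = inj₁ (refl , refl , refl)
    split-at-first []       (_ ∷ xs') ys ys' refl py c rewrite py = ⊥-elim (1+n≢0 c)
    split-at-first (x ∷ xs) []        ys ys' refl py c = inj₂ (xs , refl , refl)
    split-at-first (x ∷ xs) (_ ∷ xs') ys ys' eq py c with ∷-injective eq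
    ... | refl , eq' with p x
    ...   | true  = ⊥-elim (1+n≢0 c)
    ...   | false with split-at-first xs xs' ys ys' eq' py c
    ...     | inj₁ (refl , refl , refl) = inj₁ (refl , refl , refl)
    ...     | inj₂ (zs , refl , refl)   = inj₂ (zs , refl , refl)
    countᵇ-around-accept : ∀ {x y} xs ys → p x ≡ true → p y ≡ true →
      countᵇ p (x ∷ xs ++ y ∷ ys) ≡ 2 + (countᵇ p xs + countᵇ p ys)
    countᵇ-around-accept {x} {y} xs ys px py = begin
      countᵇ p (x ∷ xs ++ y ∷ ys)             ≡⟨ countᵇ-accept (xs ++ y ∷ ys) px ⟩
      suc (countᵇ p (xs ++ y ∷ ys))           ≡⟨ cong suc (countᵇ-++ xs (y ∷ ys)) ⟩
      suc (countᵇ p xs + countᵇ p (y ∷ ys))   ≡⟨ cong (λ n → suc (countᵇ p xs + n)) (countᵇ-accept ys py) ⟩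
      suc (countᵇ p xs + suc (countᵇ p ys))   ≡⟨ cong suc (+-suc (countᵇ p xs) (countᵇ p ys)) ⟩
      2 + (countᵇ p xs + countᵇ p ys)         ∎
      where open ≡-Reasoning

    countᵇ-around-reject : ∀ {x y} xs ys → p x ≡ false → p y ≡ false →
      countᵇ p (x ∷ xs ++ y ∷ ys) ≡ countᵇ p xs + countᵇ p ys
    countᵇ-around-reject {x} {y} xs ys px py = begin
      countᵇ p (x ∷ xs ++ y ∷ ys)             ≡⟨ countᵇ-reject (xs ++ y ∷ ys) px ⟩
      countᵇ p (xs ++ y ∷ ys)                 ≡⟨ countᵇ-++ xs (y ∷ ys) ⟩
      countᵇ p xs + countᵇ p (y ∷ ys)         ≡⟨ cong (countᵇ p xs +_) (countᵇ-reject ys py) ⟩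
      countᵇ p xs + countᵇ p ys               ∎
      where open ≡-Reasoning

    countᵇ-pair≤2 : ∀ xs {x} ys {y} zs → p x ≡ true → p y ≡ true →
      countᵇ p (xs ++ x ∷ ys ++ y ∷ zs) ≤ 2 →
      countᵇ p xs ≡ 0 × countᵇ p ys ≡ 0 × countᵇ p zs ≡ 0
    countᵇ-pair≤2 xs {x} ys {y} zs px py le =
      m+n≡0⇒m≡0 (countᵇ p xs) total≡0 , m+n≡0⇒m≡0 (countᵇ p ys) ys+zs≡0 , m+n≡0⇒n≡0 (countᵇ p ys) ys+zs≡0
      where
      total : countᵇ p (xs ++ x ∷ ys ++ y ∷ zs) ≡ 2 + (countᵇ p xs + (countᵇ p ys + countᵇ p zs))
      total = begin
        countᵇ p (xs ++ x ∷ ys ++ y ∷ zs)                          ≡⟨ countᵇ-++ xs (x ∷ ys ++ y ∷ zs) ⟩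
        countᵇ p xs + countᵇ p (x ∷ ys ++ y ∷ zs)                  ≡⟨ cong (countᵇ p xs +_) (countᵇ-around-accept ys zs px py) ⟩
        countᵇ p xs + (2 + (countᵇ p ys + countᵇ p zs))            ≡⟨ +-suc (countᵇ p xs) _ ⟩
        suc (countᵇ p xs + suc (countᵇ p ys + countᵇ p zs))        ≡⟨ cong suc (+-suc (countᵇ p xs) _) ⟩
        2 + (countᵇ p xs + (countᵇ p ys + countᵇ p zs))            ∎
        where open ≡-Reasoning
      total≡0 : countᵇ p xs + (countᵇ p ys + countᵇ p zs) ≡ 0
      total≡0 = n≤0⇒n≡0 (+-cancelˡ-≤ 2 _ 0 (subst (_≤ 2) total le))
      ys+zs≡0 = m+n≡0⇒n≡0 (countᵇ p xs) total≡0

    split-at-pair : ∀ xs {x} ys xs' {d} ms {u} ns → xs ++ x ∷ ys ≡ xs' ++ d ∷ ms ++ u ∷ ns →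
      p x ≡ true → p d ≡ true → p u ≡ true → countᵇ p (xs' ++ d ∷ ms ++ u ∷ ns) ≤ 2 →
      (xs ≡ xs' × x ≡ d × ys ≡ ms ++ u ∷ ns) ⊎ (xs ≡ xs' ++ d ∷ ms × x ≡ u × ys ≡ ns)
    split-at-pair xs ys xs' ms ns eq px pd pu le
      with countᵇ-pair≤2 xs' ms ns pd pu le
    ... | xs'≡0 , ms≡0 , ns≡0 with split-at-first xs xs' ys (ms ++ _ ∷ ns) eq px xs'≡0
    ...   | inj₁ first = inj₁ first
    ...   | inj₂ (zs , refl , eq') with split-at-first zs ms ys ns (sym eq') px ms≡0
    ...     | inj₁ (refl , x≡u , ys≡ns) = inj₂ (refl , x≡u , ys≡ns)
    ...     | inj₂ (zs' , _ , ns≡) = ⊥-elim (countᵇ-++-∷≢0 zs' ys px (trans (cong (countᵇ p) (sym ns≡)) ns≡0))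

    filterᵇ-around-accept : ∀ {x y} xs ys → p x ≡ true → p y ≡ true →
      filterᵇ p (x ∷ xs ++ y ∷ ys) ≡ x ∷ filterᵇ p xs ++ y ∷ filterᵇ p ys
    filterᵇ-around-accept {x} {y} xs ys px py = begin
      filterᵇ p (x ∷ xs ++ y ∷ ys)                ≡⟨ filterᵇ-accept (xs ++ y ∷ ys) px ⟩
      x ∷ filterᵇ p (xs ++ y ∷ ys)                ≡⟨ cong (x ∷_) (filter-++ (T? ∘ p) xs (y ∷ ys)) ⟩
      x ∷ filterᵇ p xs ++ filterᵇ p (y ∷ ys)      ≡⟨ cong (λ t → x ∷ filterᵇ p xs ++ t) (filterᵇ-accept ys py) ⟩
      x ∷ filterᵇ p xs ++ y ∷ filterᵇ p ys        ∎
      where open ≡-Reasoning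

    filterᵇ-around-reject : ∀ {x y} xs ys → p x ≡ false → p y ≡ false →
      filterᵇ p (x ∷ xs ++ y ∷ ys) ≡ filterᵇ p xs ++ filterᵇ p ys
    filterᵇ-around-reject {x} {y} xs ys px py = begin
      filterᵇ p (x ∷ xs ++ y ∷ ys)                ≡⟨ filterᵇ-reject (xs ++ y ∷ ys) px ⟩
      filterᵇ p (xs ++ y ∷ ys)                    ≡⟨ filter-++ (T? ∘ p) xs (y ∷ ys) ⟩
      filterᵇ p xs ++ filterᵇ p (y ∷ ys)          ≡⟨ cong (filterᵇ p xs ++_) (filterᵇ-reject ys py) ⟩
      filterᵇ p xs ++ filterᵇ p ys                ∎
      where open ≡-Reasoning


  filterᵇ-filterᵇ : ∀ (p q : A → Bool) xs → filterᵇ p (filterᵇ q xs) ≡ filterᵇ (λ x → q x ∧ p x) xs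
  filterᵇ-filterᵇ p q []       = refl
  filterᵇ-filterᵇ p q (x ∷ xs) with q x
  ... | false = filterᵇ-filterᵇ p q xs
  ... | true with p x
  ...   | true  = cong (x ∷_) (filterᵇ-filterᵇ p q xs)
  ...   | false = filterᵇ-filterᵇ p q xs

  filterᵇ-++-comm : ∀ (p : A → Bool) xs ys → filterᵇ p xs ≡ [] → filterᵇ p (xs ++ ys) ≡ filterᵇ p (ys ++ xs)
  filterᵇ-++-comm p xs ys none = begin
    filterᵇ p (xs ++ ys)               ≡⟨ filter-++ (T? ∘ p) xs ys ⟩
    filterᵇ p xs ++ filterᵇ p ys       ≡⟨ cong (_++ filterᵇ p ys) none ⟩
    filterᵇ p ys                       ≡⟨ ++-identityʳ _ ⟨
    filterᵇ p ys ++ []                 ≡⟨ cong (filterᵇ p ys ++_) none ⟨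
    filterᵇ p ys ++ filterᵇ p xs       ≡⟨ filter-++ (T? ∘ p) ys xs ⟨
    filterᵇ p (ys ++ xs)               ∎
    where open ≡-Reasoning

  filterᵇ-cong : ∀ {p q : A → Bool} xs → (∀ x → p x ≡ q x) → filterᵇ p xs ≡ filterᵇ q xs
  filterᵇ-cong     []       _ = refl
  filterᵇ-cong {p} {q} (x ∷ xs) h with p x | q x | h x
  ... | true  | true  | refl = cong (x ∷_) (filterᵇ-cong xs h)
  ... | false | false | refl = filterᵇ-cong xs h

module _ {A B : Set} (p : B → Bool) (g : A → B) where

  countᵇ-map : ∀ xs → countᵇ p (map g xs) ≡ countᵇ (p ∘ g) xs
  countᵇ-map []       = refl
  countᵇ-map (x ∷ xs) with p (g x)
  ... | true  = cong suc (countᵇ-map xs)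
  ... | false = countᵇ-map xs

  filterᵇ-map : ∀ xs → filterᵇ p (map g xs) ≡ map g (filterᵇ (p ∘ g) xs)
  filterᵇ-map []       = refl
  filterᵇ-map (x ∷ xs) with p (g x)
  ... | true  = cong (g x ∷_) (filterᵇ-map xs)
  ... | false = filterᵇ-map xs

module _ {X : Set} where

  IsRotationOf : List X → List X → Set
  IsRotationOf S W = Σ (List X) λ A → Σ (List X) λ B → W ≡ A ++ B × S ≡ B ++ A

  rotation-countᵇ : ∀ (p : X → Bool) {S W} → IsRotationOf S W → countᵇ p S ≡ countᵇ p W
  rotation-countᵇ p (A , B , refl , refl) = begin
    countᵇ p (B ++ A)            ≡⟨ countᵇ-++ p B A ⟩
    countᵇ p B + countᵇ p A      ≡⟨ +-comm (countᵇ p B) _ ⟩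
    countᵇ p A + countᵇ p B      ≡⟨ countᵇ-++ p A B ⟨
    countᵇ p (A ++ B)            ∎
    where open ≡-Reasoning

  rotation-∷ : ∀ {x S W} → IsRotationOf (x ∷ S) W →
               Σ (List X) λ A → Σ (List X) λ B → W ≡ A ++ x ∷ B × S ≡ B ++ A
  rotation-∷ {S = S} (A , []    , refl , refl) = [] , S , ++-identityʳ (_ ∷ S) , sym (++-identityʳ S)
  rotation-∷         (A , _ ∷ B , refl , refl) = A , B , refl , refl

  rotation-∷ʳ : ∀ {x S W} → IsRotationOf (x ∷ S) W → IsRotationOf (S ++ [ x ]) W
  rotation-∷ʳ {x} r with rotation-∷ r
  ... | A , B , refl , refl = A ++ [ x ] , B , sym (++-assoc A [ x ] B) , ++-assoc B A [ x ]

  rotation-move : ∀ P {x} R {W} → IsRotationOf (P ++ x ∷ R) W → IsRotationOf (x ∷ R ++ P) W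
  rotation-move []      {x} R r = subst (λ S → IsRotationOf (x ∷ S) _) (sym (++-identityʳ R)) r
  rotation-move (y ∷ P) {x} R r =
    subst (λ S → IsRotationOf (x ∷ S) _) (++-assoc R [ y ] P)
      (rotation-move P (R ++ [ y ]) (subst (λ S → IsRotationOf S _) (++-assoc P (x ∷ R) [ y ]) (rotation-∷ʳ r)))

  IsPrefixOf : List X → List X → Set
  IsPrefixOf w S = Σ (List X) λ Z → S ≡ w ++ Z

  take-isPrefixOf : ∀ n xs → IsPrefixOf (take n xs) xs
  take-isPrefixOf n xs = drop n xs , sym (take++drop≡id n xs)

  take-isPrefixOf-++-take : ∀ n A B k → n ≤ length A + k → IsPrefixOf (take n (A ++ B)) (A ++ take k B)
  take-isPrefixOf-++-take n       []      B k n≤k with take-isPrefixOf n (take k B)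
  ... | Z , eq = Z , trans eq (cong (_++ Z) (trans (take-take n k B) (cong (λ m → take m B) (m≤n⇒m⊓n≡m n≤k))))
  take-isPrefixOf-++-take zero    (a ∷ A) B k _         = a ∷ A ++ take k B , refl
  take-isPrefixOf-++-take (suc n) (a ∷ A) B k (s≤s le) with take-isPrefixOf-++-take n A B k le
  ... | Z , eq = Z , cong (a ∷_) eq

  drop-++-≤ : ∀ k (A B : List X) → k ≤ length A → drop k (A ++ B) ≡ drop k A ++ B
  drop-++-≤ zero    A       B _        = refl
  drop-++-≤ (suc k) (a ∷ A) B (s≤s le) = drop-++-≤ k A B le

  drop-++-≥ : ∀ k (A B : List X) → length A ≤ k → drop k (A ++ B) ≡ drop (k ∸ length A) B
  drop-++-≥ k       []      B _        = refl
  drop-++-≥ (suc k) (a ∷ A) B (s≤s le) = drop-++-≥ k A B le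

  take-suc : ∀ m (xs : List X) → take (suc m) xs ≡ take m xs ⊎ Σ X λ y → take (suc m) xs ≡ take m xs ++ [ y ]
  take-suc zero    []       = inj₁ refl
  take-suc zero    (x ∷ xs) = inj₂ (x , refl)
  take-suc (suc m) []       = inj₁ refl
  take-suc (suc m) (x ∷ xs) with take-suc m xs
  ... | inj₁ eq       = inj₁ (cong (x ∷_) eq)
  ... | inj₂ (y , eq) = inj₂ (y , cong (x ∷_) eq)

  drop-suc : ∀ k (xs : List X) → (drop k xs ≡ [] × drop (suc k) xs ≡ []) ⊎ Σ X λ y → drop k xs ≡ y ∷ drop (suc k) xs
  drop-suc zero    []       = inj₁ (refl , refl)
  drop-suc zero    (x ∷ xs) = inj₂ (x , refl)
  drop-suc (suc k) []       = inj₁ (refl , refl)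
  drop-suc (suc k) (x ∷ xs) = drop-suc k xs

  window-isPrefixOf-rotation : ∀ (W : List X) k n → n ≤ length W →
    Σ (List X) λ S → IsRotationOf S W × IsPrefixOf (take n (drop k (W ++ W))) S
  window-isPrefixOf-rotation W k n n≤N with k ≤? length W
  ... | yes k≤N = drop k W ++ take k W , (take k W , drop k W , sym (take++drop≡id k W) , refl) ,
    subst (λ ws → IsPrefixOf (take n ws) (drop k W ++ take k W)) (sym (drop-++-≤ k W W k≤N))
      (take-isPrefixOf-++-take n (drop k W) W k (≤-trans n≤N (≤-reflexive (sym length-drop+k))))
    where
    length-drop+k : length (drop k W) + k ≡ length W
    length-drop+k = trans (cong (_+ k) (length-drop k W)) (m∸n+n≡m k≤N)
  ... | no k≰N with take-isPrefixOf n (drop k' W)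
    where k' = k ∸ length W
  ...   | Z , eq = drop k' W ++ take k' W , (take k' W , drop k' W , sym (take++drop≡id k' W) , refl) ,
    Z ++ take k' W , trans (cong (_++ take k' W) eq')
                        (++-assoc (take n (drop k (W ++ W))) Z (take k' W))
    where
    k' = k ∸ length W
    eq' : drop k' W ≡ take n (drop k (W ++ W)) ++ Z
    eq' = trans eq (cong (λ ws → take n ws ++ Z) (sym (drop-++-≥ k W W (<⇒≤ (≰⇒> k≰N)))))


-- Contractions and edit distance

module _ {L : Set} where

  data Contraction : Forest L → Forest L → Set where
    here   : ∀ {l cs f} → Contraction ((l , node cs) ∷ f) (cs ++ f)
    inside : ∀ {l cs cs' f} → Contraction cs cs' →
             Contraction ((l , node cs) ∷ f) ((l , node cs') ∷ f)
    later  : ∀ {x f f'} → Contraction f f' → Contraction (x ∷ f) (x ∷ f')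

  ContractionT : Tree L → Tree L → Set
  ContractionT (node f) (node g) = Contraction f g

  contraction⇒stepF : ∀ {F G : Forest L} → Contraction F G → StepF F G
  contraction⇒stepF here       = contract
  contraction⇒stepF (inside c) = inside (contraction⇒stepF c)
  contraction⇒stepF (later c)  = later (contraction⇒stepF c)

  stepF-++ʳ : ∀ {F F' : Forest L} H → StepF F F' → StepF (F ++ H) (F' ++ H)
  stepF-++ʳ H relabel = relabel
  stepF-++ʳ H (contract {l} {cs} {f}) =
    subst (StepF ((l , node cs) ∷ (f ++ H))) (sym (++-assoc cs f H)) contract
  stepF-++ʳ H (inside s) = inside s
  stepF-++ʳ H (later s)  = later (stepF-++ʳ H s)

  stepF-++ˡ : ∀ (H : Forest L) {F F'} → StepF F F' → StepF (H ++ F) (H ++ F')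
  stepF-++ˡ []      s = s
  stepF-++ˡ (x ∷ H) s = later (stepF-++ˡ H s)

  contraction-++ʳ : ∀ {F F' : Forest L} H → Contraction F F' → Contraction (F ++ H) (F' ++ H)
  contraction-++ʳ H (here {l} {cs} {f}) =
    subst (Contraction ((l , node cs) ∷ (f ++ H))) (sym (++-assoc cs f H)) here
  contraction-++ʳ H (inside c) = inside c
  contraction-++ʳ H (later c)  = later (contraction-++ʳ H c)

  contraction-++ˡ : ∀ (H : Forest L) {F F'} → Contraction F F' → Contraction (H ++ F) (H ++ F')
  contraction-++ˡ []      c = c
  contraction-++ˡ (x ∷ H) c = later (contraction-++ˡ H c)

  data StepVsContraction (A' B : Forest L) : Set where
    coincide  : A' ≡ B → StepVsContraction A' B
    absorbed  : Contraction A' B → StepVsContraction A' B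
    commute   : ∀ {B' : Forest L} → StepF B B' → Contraction A' B' → StepVsContraction A' B

  step-vs-contraction : ∀ {A A' B : Forest L} → StepF A A' → Contraction A B → StepVsContraction A' B
  step-vs-contraction relabel here       = absorbed here
  step-vs-contraction relabel (inside c) = commute relabel (inside c)
  step-vs-contraction relabel (later c)  = commute relabel (later c)
  step-vs-contraction contract here      = coincide refl
  step-vs-contraction (contract {f = f}) (inside c)   = commute contract (contraction-++ʳ f c)
  step-vs-contraction (contract {cs = cs}) (later c)  = commute contract (contraction-++ˡ cs c)
  step-vs-contraction (inside {f = f} s) here         = commute (stepF-++ʳ f s) here
  step-vs-contraction (inside s) (inside c) with step-vs-contraction s c
  ... | coincide refl = coincide refl
  ... | absorbed c'   = absorbed (inside c')
  ... | commute s' c' = commute (inside s') (inside c')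
  step-vs-contraction (inside s) (later c) = commute (inside s) (later c)
  step-vs-contraction (later {x = _ , node cs} s) here = commute (stepF-++ˡ cs s) here
  step-vs-contraction (later s) (inside c) = commute (later s) (inside c)
  step-vs-contraction (later s) (later c) with step-vs-contraction s c
  ... | coincide refl = coincide refl
  ... | absorbed c'   = absorbed (later c')
  ... | commute s' c' = commute (later s') (later c')

  data StepsVsContraction (n : ℕ) (B : Forest L) (S : Tree L) : Set where
    shorter  : ∀ {m} → m < n → Steps m (node B) S → StepsVsContraction n B S
    trailing : ∀ {m} {S' : Tree L} → m ≤ n → Steps m (node B) S' → ContractionT S S' →
               StepsVsContraction n B S

  steps-vs-contraction : ∀ {n} {A B : Forest L} {S} → Steps n (node A) S → Contraction A B →
                         StepsVsContraction n B S
  steps-vs-contraction done c = trailing z≤n done c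
  steps-vs-contraction (more (step s) rest) c with step-vs-contraction s c
  ... | coincide refl = shorter ≤-refl rest
  ... | absorbed c' with steps-vs-contraction rest c'
  ...   | shorter le st    = shorter (m≤n⇒m≤1+n le) st
  ...   | trailing le st c'' = trailing (m≤n⇒m≤1+n le) st c''
  steps-vs-contraction (more (step s) rest) c | commute s' c' with steps-vs-contraction rest c'
  ...   | shorter le st    = shorter (s≤s le) (more (step s') st)
  ...   | trailing le st c'' = trailing (s≤s le) (more (step s') st) c''

  steps-∷ʳ : ∀ {n} {T S S' : Tree L} → Steps n T S → ContractionT S S' → Steps (suc n) T S'
  steps-∷ʳ {S = node _} {node _} done c = more (step (contraction⇒stepF c)) done
  steps-∷ʳ (more s rest) c = more s (steps-∷ʳ rest c)

  ed-contraction : ∀ {T : Tree L} {A B dA dB} → Contraction A B →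
                   IsEd T (node A) dA → IsEd T (node B) dB → dB ≤ suc dA
  ed-contraction c ((a , b , S , T⟶S , A⟶S , refl) , _) (_ , minimal)
    with steps-vs-contraction A⟶S c
  ... | shorter {m} m<b st =
    ≤-trans (minimal a m S T⟶S st) (m≤n⇒m≤1+n (+-monoʳ-≤ a (<⇒≤ m<b)))
  ... | trailing {m} {S'} m≤b st c' =
    ≤-trans (minimal (suc a) m S' (steps-∷ʳ T⟶S c') st) (s≤s (+-monoʳ-≤ a m≤b))

  sizeF-++ : ∀ (F G : Forest L) → sizeF (F ++ G) ≡ sizeF F + sizeF G
  sizeF-++ []                  G = refl
  sizeF-++ ((_ , node cs) ∷ F) G =
    cong suc (trans (cong (sizeF cs +_) (sizeF-++ F G)) (sym (+-assoc (sizeF cs) _ _)))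

  sizeF-contraction : ∀ {F G : Forest L} → Contraction F G → sizeF F ≡ suc (sizeF G)
  sizeF-contraction (here {cs = cs} {f}) = cong suc (sym (sizeF-++ cs f))
  sizeF-contraction (inside {f = f} c)   = cong (λ n → suc (n + sizeF f)) (sizeF-contraction c)
  sizeF-contraction (later {x = _ , node cs} {f' = f'} c) =
    cong suc (trans (cong (sizeF cs +_) (sizeF-contraction c)) (+-suc (sizeF cs) (sizeF f')))

  ed-unique : ∀ {T A : Tree L} {d d'} → IsEd T A d → IsEd T A d' → d ≡ d'
  ed-unique ((a , b , S , s₁ , s₂ , refl) , min) ((a' , b' , S' , s₁' , s₂' , refl) , min') =
    ≤-antisym (min a' b' S' s₁' s₂') (min' a b S s₁ s₂)

  sim-unique : ∀ {T A : Tree L} {s s'} → IsSim T A s → IsSim T A s' → s ≡ s'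
  sim-unique (d , ed , refl) (d' , ed' , refl) = cong (_ ∸_) (ed-unique ed ed')

  -- A has one edge more than B, and ed(T, B) ≤ ed(T, A) + 1.
  sim-contraction : ∀ {T : Tree L} {A B s s'} → Contraction A B →
                    IsSim T (node A) s → IsSim T (node B) s' → s ≤ s' + 2
  sim-contraction {T} {A} {B} c (dA , edA , refl) (dB , edB , refl) = begin
    size T + sizeF A ∸ dA          ≡⟨ cong (λ n → size T + n ∸ dA) (sizeF-contraction c) ⟩
    size T + suc (sizeF B) ∸ dA    ≡⟨ cong (_∸ dA) (+-suc (size T) (sizeF B)) ⟩
    2 + u ∸ suc dA                 ≤⟨ ∸-monoʳ-≤ (2 + u) (ed-contraction c edA edB) ⟩
    2 + u ∸ dB                     ≡⟨ cong (_∸ dB) (+-comm 2 u) ⟩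
    u + 2 ∸ dB                     ≤⟨ m+n∸o≤m∸o+n u 2 dB ⟩
    u ∸ dB + 2                     ∎
    where
    open ≤-Reasoning
    u = size T + sizeF B

mapF-++ : ∀ {A B : Set} (g : A → B) (F G : Forest A) → mapF g (F ++ G) ≡ mapF g F ++ mapF g G
mapF-++ g []                  G = refl
mapF-++ g ((a , node cs) ∷ F) G = cong (_ ∷_) (mapF-++ g F G)

contraction-mapF : ∀ {A B : Set} (g : A → B) {F G : Forest A} → Contraction F G →
                   Contraction (mapF g F) (mapF g G)
contraction-mapF g (here {l} {cs} {f}) =
  subst (Contraction (mapF g ((l , node cs) ∷ f))) (sym (mapF-++ g cs f)) here
contraction-mapF g (inside c)                  = inside (contraction-mapF g c)
contraction-mapF g (later {x = _ , node _} c)  = later (contraction-mapF g c)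

EqualOrContraction : {A : Set} → Tree A → Tree A → Set
EqualOrContraction B C = B ≡ C ⊎ ContractionT B C

sim-≡⊎contraction : ∀ {A L : Set} (g : A → L) {T : Tree L} {B C : Tree A} {s s'} →
  EqualOrContraction B C → IsSim T (mapT g B) s → IsSim T (mapT g C) s' → s ≤ s' + 2
sim-≡⊎contraction g (inj₁ refl) simB simC = ≤-trans (≤-reflexive (sim-unique simB simC)) (m≤m+n _ 2)
sim-≡⊎contraction g {B = node _} {node _} (inj₂ c) simB simC = sim-contraction (contraction-mapF g c) simB simC


-- Edge tours

edgeTourF : {A : Set} → Forest A → List A
edgeTourF []                  = []
edgeTourF ((a , node cs) ∷ f) = a ∷ edgeTourF cs ++ a ∷ edgeTourF f

edgeTourT : {A : Set} → Tree A → List A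
edgeTourT (node f) = edgeTourF f

edgeTourF-++ : ∀ {A : Set} (F G : Forest A) → edgeTourF (F ++ G) ≡ edgeTourF F ++ edgeTourF G
edgeTourF-++ []                  G = refl
edgeTourF-++ ((a , node cs) ∷ F) G = cong (a ∷_) (begin
  edgeTourF cs ++ a ∷ edgeTourF (F ++ G)            ≡⟨ cong (λ t → edgeTourF cs ++ a ∷ t) (edgeTourF-++ F G) ⟩
  edgeTourF cs ++ a ∷ edgeTourF F ++ edgeTourF G    ≡⟨ ++-assoc (edgeTourF cs) (a ∷ edgeTourF F) (edgeTourF G) ⟨
  (edgeTourF cs ++ a ∷ edgeTourF F) ++ edgeTourF G  ∎)
  where open ≡-Reasoning

module _ {L : Set} where

  isEdge : ℕ → ℕ × L → Bool
  isEdge e a = e ≡ᵇ proj₁ a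

  AtMostTwice : List (ℕ × L) → Set
  AtMostTwice xs = ∀ e → countᵇ (isEdge e) xs ≤ 2

  atMostTwice-++ˡ : ∀ xs ys → AtMostTwice (xs ++ ys) → AtMostTwice xs
  atMostTwice-++ˡ xs ys m e =
    ≤-trans (≤-trans (m≤m+n _ _) (≤-reflexive (sym (countᵇ-++ (isEdge e) xs ys)))) (m e)

  atMostTwice-++ʳ : ∀ xs ys → AtMostTwice (xs ++ ys) → AtMostTwice ys
  atMostTwice-++ʳ xs ys m e =
    ≤-trans (≤-trans (m≤n+m _ _) (≤-reflexive (sym (countᵇ-++ (isEdge e) xs ys)))) (m e)

  atMostTwice-∷ : ∀ x xs → AtMostTwice (x ∷ xs) → AtMostTwice xs
  atMostTwice-∷ x xs m e = ≤-trans (countᵇ-tail x xs) (m e)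
    where
    countᵇ-tail : ∀ x xs → countᵇ (isEdge e) xs ≤ countᵇ (isEdge e) (x ∷ xs)
    countᵇ-tail x xs with isEdge e x
    ... | true  = n≤1+n _
    ... | false = ≤-refl

  atMostTwice-around : ∀ a xs ys → AtMostTwice (a ∷ xs ++ a ∷ ys) →
                       AtMostTwice xs × AtMostTwice ys
  atMostTwice-around a xs ys m =
    atMostTwice-++ˡ xs (a ∷ ys) m' , atMostTwice-∷ a ys (atMostTwice-++ʳ xs (a ∷ ys) m')
    where m' = atMostTwice-∷ a (xs ++ a ∷ ys) m

  edgeTourF-∷-own≡0 : ∀ a (cs f : Forest (ℕ × L)) → AtMostTwice (edgeTourF ((a , node cs) ∷ f)) →
    countᵇ (isEdge (proj₁ a)) (edgeTourF cs) ≡ 0 × countᵇ (isEdge (proj₁ a)) (edgeTourF f) ≡ 0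
  edgeTourF-∷-own≡0 a cs f m = proj₂ (countᵇ-pair≤2 (isEdge (proj₁ a)) [] {a} (edgeTourF cs) {a} (edgeTourF f)
                                   (≡ᵇ-refl (proj₁ a)) (≡ᵇ-refl (proj₁ a)) (m (proj₁ a)))

  edgeTourF-injective : ∀ (F G : Forest (ℕ × L)) → edgeTourF F ≡ edgeTourF G →
                        AtMostTwice (edgeTourF F) → F ≡ G
  edgeTourF-injective [] [] _ _ = refl
  edgeTourF-injective [] ((_ , node _) ∷ _) () _
  edgeTourF-injective ((_ , node _) ∷ _) [] () _
  edgeTourF-injective ((a , node cs) ∷ f) ((_ , node ds) ∷ g) eq m with ∷-injective eq
  ... | refl , eq'
    with split-at-first (isEdge (proj₁ a)) (edgeTourF ds) (edgeTourF cs) (edgeTourF g) (edgeTourF f)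
           (sym eq') (≡ᵇ-refl (proj₁ a)) cs≡0
    where cs≡0 = proj₁ (edgeTourF-∷-own≡0 a cs f m)
  ... | inj₁ (ds≡cs , _ , g≡f) =
    cong₂ (λ u v → (a , node u) ∷ v)
      (edgeTourF-injective cs ds (sym ds≡cs) (proj₁ m-cs-f))
      (edgeTourF-injective f g (sym g≡f) (proj₂ m-cs-f))
    where m-cs-f = atMostTwice-around a (edgeTourF cs) (edgeTourF f) m
  ... | inj₂ (zs , _ , f≡zs++a∷g) =
    ⊥-elim (countᵇ-++-∷≢0 (isEdge (proj₁ a)) zs (edgeTourF g) (≡ᵇ-refl (proj₁ a))
      (trans (cong (countᵇ (isEdge (proj₁ a))) (sym f≡zs++a∷g))
             (proj₂ (edgeTourF-∷-own≡0 a cs f m))))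

  module _ {e} {a : ℕ × L} (cs f : Forest (ℕ × L)) (e≢a : e ≢ proj₁ a) where

    countᵇ-edgeTourF-∷-≢ : countᵇ (isEdge e) (edgeTourF ((a , node cs) ∷ f)) ≡
                           countᵇ (isEdge e) (edgeTourF cs) + countᵇ (isEdge e) (edgeTourF f)
    countᵇ-edgeTourF-∷-≢ = countᵇ-around-reject (isEdge e) {a} {a} (edgeTourF cs) (edgeTourF f) a∉ a∉
      where a∉ = ≢⇒≡ᵇ≡false e (proj₁ a) e≢a

    filterᵇ-edgeTourF-∷-≢ : filterᵇ (not ∘ isEdge e) (edgeTourF ((a , node cs) ∷ f)) ≡
      a ∷ filterᵇ (not ∘ isEdge e) (edgeTourF cs) ++ a ∷ filterᵇ (not ∘ isEdge e) (edgeTourF f)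
    filterᵇ-edgeTourF-∷-≢ = filterᵇ-around-accept (not ∘ isEdge e) {a} {a} (edgeTourF cs) (edgeTourF f) a∉ a∉
      where a∉ = cong not (≢⇒≡ᵇ≡false e (proj₁ a) e≢a)

  countᵇ-edgeTourF-≡0⊎≥2 : ∀ F e → countᵇ (isEdge e) (edgeTourF F) ≡ 0 ⊎ 2 ≤ countᵇ (isEdge e) (edgeTourF F)
  countᵇ-edgeTourF-≡0⊎≥2 [] e = inj₁ refl
  countᵇ-edgeTourF-≡0⊎≥2 ((a , node cs) ∷ f) e with e ≟ proj₁ a
  ... | yes refl = inj₂ (≤-trans (m≤m+n 2 _) (≤-reflexive (sym
          (countᵇ-around-accept (isEdge e) {a} {a} (edgeTourF cs) (edgeTourF f) (≡ᵇ-refl e) (≡ᵇ-refl e)))))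
  ... | no e≢a with countᵇ-edgeTourF-≡0⊎≥2 cs e | countᵇ-edgeTourF-≡0⊎≥2 f e
  ...   | inj₁ cs≡0 | inj₁ f≡0 = inj₁ (trans (countᵇ-edgeTourF-∷-≢ cs f e≢a) (cong₂ _+_ cs≡0 f≡0))
  ...   | inj₂ cs≥2 | _        =
    inj₂ (≤-trans cs≥2 (≤-trans (m≤m+n _ _) (≤-reflexive (sym (countᵇ-edgeTourF-∷-≢ cs f e≢a)))))
  ...   | inj₁ cs≡0 | inj₂ f≥2 =
    inj₂ (≤-trans f≥2 (≤-trans (m≤n+m _ _) (≤-reflexive (sym (countᵇ-edgeTourF-∷-≢ cs f e≢a)))))

  contract-edge : ∀ F e → AtMostTwice (edgeTourF F) → countᵇ (isEdge e) (edgeTourF F) ≢ 0 →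
    Σ (Forest (ℕ × L)) λ F' → Contraction F F' × edgeTourF F' ≡ filterᵇ (not ∘ isEdge e) (edgeTourF F)
  contract-edge [] e m nz = ⊥-elim (nz refl)
  contract-edge ((a , node cs) ∷ f) e m nz with e ≟ proj₁ a
  ... | yes refl = cs ++ f , here , (begin
    edgeTourF (cs ++ f)                       ≡⟨ edgeTourF-++ cs f ⟩
    X ++ Y                                    ≡⟨ cong₂ _++_ (filterᵇ-not-countᵇ≡0 (isEdge e) X X≡0)
                                                            (filterᵇ-not-countᵇ≡0 (isEdge e) Y Y≡0) ⟨
    filterᵇ q X ++ filterᵇ q Y                ≡⟨ filterᵇ-around-reject q {a} {a} X Y a∈ a∈ ⟨
    filterᵇ q (a ∷ X ++ a ∷ Y)                ∎)
    where
    open ≡-Reasoning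
    X = edgeTourF cs
    Y = edgeTourF f
    q = not ∘ isEdge e
    a∈ = cong not (≡ᵇ-refl e)
    X≡0 = proj₁ (edgeTourF-∷-own≡0 a cs f m)
    Y≡0 = proj₂ (edgeTourF-∷-own≡0 a cs f m)
  ... | no e≢a with countᵇ-edgeTourF-≡0⊎≥2 cs e | atMostTwice-around a (edgeTourF cs) (edgeTourF f) m
  ...   | inj₁ X≡0 | _ , mY =
    let f' , c , tour = contract-edge f e mY
                          (λ Y≡0 → nz (trans (countᵇ-edgeTourF-∷-≢ cs f e≢a) (cong₂ _+_ X≡0 Y≡0)))
    in (a , node cs) ∷ f' , later c , (begin
      a ∷ X ++ a ∷ edgeTourF f'                    ≡⟨ cong (λ t → a ∷ X ++ a ∷ t) tour ⟩
      a ∷ X ++ a ∷ filterᵇ q Y                     ≡⟨ cong (λ t → a ∷ t ++ a ∷ filterᵇ q Y)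
                                                           (filterᵇ-not-countᵇ≡0 (isEdge e) X X≡0) ⟨
      a ∷ filterᵇ q X ++ a ∷ filterᵇ q Y           ≡⟨ filterᵇ-edgeTourF-∷-≢ cs f e≢a ⟨
      filterᵇ q (edgeTourF ((a , node cs) ∷ f))    ∎)
    where
    open ≡-Reasoning
    X = edgeTourF cs
    Y = edgeTourF f
    q = not ∘ isEdge e
  ...   | inj₂ X≥2 | mX , _ =
    let cs' , c , tour = contract-edge cs e mX (λ X≡0 → <⇒≢ (≤-trans (s≤s z≤n) X≥2) (sym X≡0))
    in (a , node cs') ∷ f , inside c , (begin
      a ∷ edgeTourF cs' ++ a ∷ Y                   ≡⟨ cong (λ t → a ∷ t ++ a ∷ Y) tour ⟩
      a ∷ filterᵇ q X ++ a ∷ Y                     ≡⟨ cong (λ t → a ∷ filterᵇ q X ++ a ∷ t)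
                                                           (filterᵇ-not-countᵇ≡0 (isEdge e) Y Y≡0) ⟨
      a ∷ filterᵇ q X ++ a ∷ filterᵇ q Y           ≡⟨ filterᵇ-edgeTourF-∷-≢ cs f e≢a ⟨
      filterᵇ q (edgeTourF ((a , node cs) ∷ f))    ∎)
    where
    open ≡-Reasoning
    X = edgeTourF cs
    Y = edgeTourF f
    q = not ∘ isEdge e
    Y≡0 : countᵇ (isEdge e) Y ≡ 0
    Y≡0 = n≤0⇒n≡0 (+-cancelˡ-≤ 2 (countᵇ (isEdge e) Y) 0
      (≤-trans (+-monoˡ-≤ _ X≥2) (≤-trans (≤-reflexive (sym (countᵇ-edgeTourF-∷-≢ cs f e≢a))) (m e))))

  filterᵇ-edgeTourF⇒contraction : ∀ (A B : Forest (ℕ × L)) e → AtMostTwice (edgeTourF A) →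
    countᵇ (isEdge e) (edgeTourF A) ≢ 0 → edgeTourF B ≡ filterᵇ (not ∘ isEdge e) (edgeTourF A) →
    Contraction A B
  filterᵇ-edgeTourF⇒contraction A B e m nz tourB
    with contract-edge A e m nz
  ... | A' , c , tourA' with edgeTourF-injective A' B (trans tourA' (sym tourB)) mA'
    where
    mA' : AtMostTwice (edgeTourF A')
    mA' e' = ≤-trans (≤-reflexive (cong (countᵇ (isEdge e')) tourA'))
                     (≤-trans (countᵇ-filterᵇ (isEdge e') _ (edgeTourF A)) (m e'))
  ... | refl = c

  edgeTourT-injective : ∀ (A B : Tree (ℕ × L)) → edgeTourT A ≡ edgeTourT B →
                        AtMostTwice (edgeTourT A) → A ≡ B
  edgeTourT-injective (node F) (node G) eq m = cong node (edgeTourF-injective F G eq m)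

  filterᵇ-edgeTourT⇒contraction : ∀ (A B : Tree (ℕ × L)) e → AtMostTwice (edgeTourT A) →
    countᵇ (isEdge e) (edgeTourT A) ≢ 0 → edgeTourT B ≡ filterᵇ (not ∘ isEdge e) (edgeTourT A) →
    ContractionT A B
  filterᵇ-edgeTourT⇒contraction (node F) (node G) = filterᵇ-edgeTourF⇒contraction F G


-- Darts, numbering and kept edges

Dart : Set → Set
Dart L = Dir × (ℕ × L)

tourF-++ : ∀ {A : Set} (F G : Forest A) → tourF (F ++ G) ≡ tourF F ++ tourF G
tourF-++ []                  G = refl
tourF-++ ((a , node cs) ∷ F) G = cong ((down , a) ∷_) (begin
  tourF cs ++ (up , a) ∷ tourF (F ++ G)             ≡⟨ cong (λ t → tourF cs ++ (up , a) ∷ t) (tourF-++ F G) ⟩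
  tourF cs ++ (up , a) ∷ tourF F ++ tourF G         ≡⟨ ++-assoc (tourF cs) ((up , a) ∷ tourF F) (tourF G) ⟨
  (tourF cs ++ (up , a) ∷ tourF F) ++ tourF G       ∎)
  where open ≡-Reasoning

map-proj₂-tourF : ∀ {A : Set} (F : Forest A) → map proj₂ (tourF F) ≡ edgeTourF F
map-proj₂-tourF []                  = refl
map-proj₂-tourF ((a , node cs) ∷ f) = cong (a ∷_) (trans (map-++ proj₂ (tourF cs) ((up , a) ∷ tourF f))
  (cong₂ (λ u v → u ++ a ∷ v) (map-proj₂-tourF cs) (map-proj₂-tourF f)))

length-tourF : ∀ {A : Set} (F : Forest A) → length (tourF F) ≡ sizeF F + sizeF F
length-tourF []                  = refl
length-tourF ((a , node cs) ∷ f) = cong suc (begin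
  length (tourF cs ++ (up , a) ∷ tourF f)           ≡⟨ length-++ (tourF cs) ⟩
  length (tourF cs) + suc (length (tourF f))        ≡⟨ cong₂ (λ u v → u + suc v) (length-tourF cs) (length-tourF f) ⟩
  sizeF cs + sizeF cs + suc (sizeF f + sizeF f)     ≡⟨ rearrange (sizeF cs) (sizeF f) ⟩
  sizeF cs + sizeF f + suc (sizeF cs + sizeF f)     ∎)
  where
  open ≡-Reasoning
  rearrange : ∀ x y → x + x + suc (y + y) ≡ x + y + suc (x + y)
  rearrange = solve-∀

module _ {L : Set} where

  edgeOfDart : Dart L → ℕ
  edgeOfDart = proj₁ ∘ proj₂

  onEdge : ℕ → Dart L → Bool
  onEdge e = isEdge e ∘ proj₂

  count≡countᵇ : ∀ e (w : List (Dart L)) → count e w ≡ countᵇ (onEdge e) w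
  count≡countᵇ e []      = refl
  count≡countᵇ e (_ ∷ w) rewrite count≡countᵇ e w = refl

  countᵇ-map-proj₂ : ∀ e (w : List (Dart L)) → countᵇ (isEdge e) (map proj₂ w) ≡ countᵇ (onEdge e) w
  countᵇ-map-proj₂ e = countᵇ-map (isEdge e) proj₂

  tourF-contractF : ∀ (K : ℕ → Bool) (F : Forest (ℕ × L)) →
                    tourF (contractF K F) ≡ filterᵇ (K ∘ edgeOfDart) (tourF F)
  tourF-contractF K []                  = refl
  tourF-contractF K ((a , node cs) ∷ f) with K (proj₁ a) in Ka
  ... | true  = cong ((down , a) ∷_) (begin
    tourF (contractF K cs) ++ (up , a) ∷ tourF (contractF K f)
      ≡⟨ cong₂ (λ u v → u ++ (up , a) ∷ v) (tourF-contractF K cs) (tourF-contractF K f) ⟩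
    filterᵇ k (tourF cs) ++ (up , a) ∷ filterᵇ k (tourF f)
      ≡⟨ cong (filterᵇ k (tourF cs) ++_) (filterᵇ-accept k (tourF f) Ka) ⟨
    filterᵇ k (tourF cs) ++ filterᵇ k ((up , a) ∷ tourF f)
      ≡⟨ filter-++ (T? ∘ k) (tourF cs) ((up , a) ∷ tourF f) ⟨
    filterᵇ k (tourF cs ++ (up , a) ∷ tourF f) ∎)
    where
    open ≡-Reasoning
    k = K ∘ edgeOfDart
  ... | false = begin
    tourF (contractF K cs ++ contractF K f)
      ≡⟨ tourF-++ (contractF K cs) (contractF K f) ⟩
    tourF (contractF K cs) ++ tourF (contractF K f)
      ≡⟨ cong₂ _++_ (tourF-contractF K cs) (tourF-contractF K f) ⟩
    filterᵇ k (tourF cs) ++ filterᵇ k (tourF f)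
      ≡⟨ cong (filterᵇ k (tourF cs) ++_) (filterᵇ-reject k (tourF f) Ka) ⟨
    filterᵇ k (tourF cs) ++ filterᵇ k ((up , a) ∷ tourF f)
      ≡⟨ filter-++ (T? ∘ k) (tourF cs) ((up , a) ∷ tourF f) ⟨
    filterᵇ k (tourF cs ++ (up , a) ∷ tourF f) ∎
    where
    open ≡-Reasoning
    k = K ∘ edgeOfDart

  record NumberedFrom (n n' : ℕ) (F : Forest (ℕ × L)) : Set where
    field
      n≤n'        : n ≤ n'
      outside≡0   : ∀ e → e < n ⊎ n' ≤ e → countᵇ (onEdge e) (tourF F) ≡ 0
      atMostTwice : ∀ e → countᵇ (onEdge e) (tourF F) ≤ 2

  numF-numberedFrom : ∀ n (f : Forest L) → NumberedFrom n (proj₂ (numF n f)) (proj₁ (numF n f))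
  numF-numberedFrom n []      = record { n≤n' = ≤-refl ; outside≡0 = λ _ _ → refl ; atMostTwice = λ _ → z≤n }
  numF-numberedFrom n ((l , node cs) ∷ f) with numF (suc n) cs | numF-numberedFrom (suc n) cs
  ... | cs' , n₁ | Ncs with numF n₁ f | numF-numberedFrom n₁ f
  ...   | f' , n₂ | Nf = record
    { n≤n'        = n≤n₂
    ; outside≡0   = outside
    ; atMostTwice = twice
    }
    where
    open NumberedFrom
    n≤n₂ : n ≤ n₂
    n≤n₂ = ≤-trans (n≤1+n n) (≤-trans (n≤n' Ncs) (n≤n' Nf))
    split : ∀ e → e ≢ n → countᵇ (onEdge e) (tourF (((n , l) , node cs') ∷ f')) ≡
                          countᵇ (onEdge e) (tourF cs') + countᵇ (onEdge e) (tourF f')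
    split e e≢n = countᵇ-around-reject (onEdge e) {down , (n , l)} {up , (n , l)} (tourF cs') (tourF f') n∉ n∉
      where n∉ = ≢⇒≡ᵇ≡false e n e≢n
    outside : ∀ e → e < n ⊎ n₂ ≤ e → countᵇ (onEdge e) (tourF (((n , l) , node cs') ∷ f')) ≡ 0
    n<n₁ : n < n₁
    n<n₁ = ≤-trans (n<1+n n) (n≤n' Ncs)
    outside e (inj₁ e<n) = trans (split e (<⇒≢ e<n))
      (cong₂ _+_ (outside≡0 Ncs e (inj₁ (m≤n⇒m≤1+n e<n))) (outside≡0 Nf e (inj₁ (<-trans e<n n<n₁))))
    outside e (inj₂ n₂≤e) =
      trans (split e (λ { refl → <⇒≱ (≤-trans n<n₁ (n≤n' Nf)) n₂≤e }))
            (cong₂ _+_ (outside≡0 Ncs e (inj₂ (≤-trans (n≤n' Nf) n₂≤e))) (outside≡0 Nf e (inj₂ n₂≤e)))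
    twice : ∀ e → countᵇ (onEdge e) (tourF (((n , l) , node cs') ∷ f')) ≤ 2
    twice e with e ≟ n
    ... | yes refl = ≤-reflexive (trans
      (countᵇ-around-accept (onEdge e) {down , (n , l)} {up , (n , l)} (tourF cs') (tourF f') (≡ᵇ-refl e) (≡ᵇ-refl e))
      (cong₂ (λ u v → 2 + (u + v)) (outside≡0 Ncs e (inj₁ (n<1+n e))) (outside≡0 Nf e (inj₁ n<n₁))))
    ... | no e≢n with e <? n₁
    ...   | yes e<n₁ = ≤-trans (≤-reflexive (trans (split e e≢n)
                                   (trans (cong (_ +_) (outside≡0 Nf e (inj₁ e<n₁))) (+-identityʳ _))))
                               (atMostTwice Ncs e)
    ...   | no e≮n₁ = ≤-trans (≤-reflexive (trans (split e e≢n)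
                                  (cong (_+ _) (outside≡0 Ncs e (inj₂ (≮⇒≥ e≮n₁))))))
                              (atMostTwice Nf e)

  sizeF-numF : ∀ n (f : Forest L) → sizeF (proj₁ (numF n f)) ≡ sizeF f
  sizeF-numF n []      = refl
  sizeF-numF n ((l , node cs) ∷ f) with numF (suc n) cs | sizeF-numF (suc n) cs
  ... | cs' , n₁ | size-cs with numF n₁ f | sizeF-numF n₁ f
  ...   | f' , n₂ | size-f = cong suc (cong₂ _+_ size-cs size-f)

agree-everywhere : ∀ (K K' : ℕ → Bool) e₀ → (∀ e → e ≢ e₀ → K' e ≡ K e) → K' e₀ ≡ K e₀ →
                   ∀ e → K' e ≡ K e
agree-everywhere K K' e₀ agree at-e₀ e with e ≟ e₀
... | yes refl = at-e₀
... | no e≢e₀  = agree e e≢e₀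

agree-or-newly-kept : ∀ (K K' : ℕ → Bool) e₀ → (∀ e → e ≢ e₀ → K' e ≡ K e) → (K e₀ ≡ true → K' e₀ ≡ true) →
  (∀ e → K' e ≡ K e) ⊎ (K' e₀ ≡ true × K e₀ ≡ false)
agree-or-newly-kept K K' e₀ agree mono with K e₀ in K₀ | K' e₀ in K'₀
... | true  | true  = inj₁ (agree-everywhere K K' e₀ agree (trans K'₀ (sym K₀)))
... | false | false = inj₁ (agree-everywhere K K' e₀ agree (trans K'₀ (sym K₀)))
... | false | true  = inj₂ (refl , refl)
... | true  | false = case mono refl of λ ()

module _ {L : Set} where

  filterᵇ-newly-kept : ∀ (K K' : ℕ → Bool) e₀ → K' e₀ ≡ true → K e₀ ≡ false → (∀ e → e ≢ e₀ → K' e ≡ K e) →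
    ∀ (xs : List (Dart L)) →
    filterᵇ (K ∘ edgeOfDart) xs ≡ filterᵇ (not ∘ onEdge e₀) (filterᵇ (K' ∘ edgeOfDart) xs)
  filterᵇ-newly-kept K K' e₀ K'₀ K₀ agree xs =
    trans (filterᵇ-cong xs pointwise) (sym (filterᵇ-filterᵇ (not ∘ onEdge e₀) (K' ∘ edgeOfDart) xs))
    where
    pointwise : ∀ (x : Dart L) → K (edgeOfDart x) ≡ K' (edgeOfDart x) ∧ not (onEdge e₀ x)
    pointwise x with e₀ ≟ edgeOfDart x
    ... | yes refl = trans K₀ (sym (trans (cong (λ b → K' e₀ ∧ not b) (≡ᵇ-refl e₀)) (∧-zeroʳ _)))
    ... | no e₀≢x  = trans (sym (agree _ (e₀≢x ∘ sym)))
      (sym (trans (cong (λ b → K' (edgeOfDart x) ∧ not b) (≢⇒≡ᵇ≡false e₀ (edgeOfDart x) e₀≢x)) (∧-identityʳ _)))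

  firstKept-nothing : ∀ (K : ℕ → Bool) (w : List (Dart L)) → firstKept K w ≡ nothing →
                      ∀ e → K e ≡ true → countᵇ (onEdge e) w ≡ 0
  firstKept-nothing K []            _    e Ke = refl
  firstKept-nothing K ((d , a) ∷ w) none e Ke with K (proj₁ a) in Ka
  ... | false with e ≟ proj₁ a
  ...   | yes refl = case trans (sym Ke) Ka of λ ()
  ...   | no e≢a   = trans (countᵇ-reject (onEdge e) {d , a} w (≢⇒≡ᵇ≡false e (proj₁ a) e≢a))
                           (firstKept-nothing K w none e Ke)

  firstKept-just : ∀ (K : ℕ → Bool) (w : List (Dart L)) {x} → firstKept K w ≡ just x →
    Σ (List (Dart L)) λ P → Σ (List (Dart L)) λ R →
      w ≡ P ++ x ∷ R × K (edgeOfDart x) ≡ true × filterᵇ (K ∘ edgeOfDart) P ≡ []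
  firstKept-just K ((d , a) ∷ w) found with K (proj₁ a) in Ka
  ... | true with found
  ...   | refl = [] , w , refl , Ka , refl
  firstKept-just K ((d , a) ∷ w) found | false with firstKept-just K w found
  ...   | P , R , refl , Kx , none = (d , a) ∷ P , R , refl , Kx , trans (filterᵇ-reject (K ∘ edgeOfDart) P Ka) none


-- Rerooting

module _ {L : Set} where

  tourLeftOf : List (Frame (ℕ × L)) → List (Dart L)
  tourLeftOf []                   = []
  tourLeftOf ((ls , b , _) ∷ fs)  = tourLeftOf fs ++ tourF ls ++ [ (down , b) ]

  tourRightOf : List (Frame (ℕ × L)) → List (Dart L)
  tourRightOf []                  = []
  tourRightOf ((_ , b , rs) ∷ fs) = (up , b) ∷ tourF rs ++ tourRightOf fs

  Found : Set
  Found = List (Frame (ℕ × L)) × Forest (ℕ × L) × (ℕ × L) × Tree (ℕ × L) × Forest (ℕ × L)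

  foundEdge : Found → ℕ × L
  foundEdge (_ , _ , a , _ , _) = a

  tourAround : Found → List (Dart L)
  tourAround (ctx , pre , a , node cs , rs) =
    tourLeftOf ctx ++ tourF pre ++ (down , a) ∷ tourF cs ++ (up , a) ∷ tourF rs ++ tourRightOf ctx

  findF-sound : ∀ e ctx pre (F : Forest (ℕ × L)) r → findF e ctx pre F ≡ just r →
    tourLeftOf ctx ++ tourF pre ++ tourF F ++ tourRightOf ctx ≡ tourAround r × proj₁ (foundEdge r) ≡ e
  findF-sound e ctx pre ((a , node cs) ∷ rs) r found with proj₁ a ≡ᵇ e in a≡e
  ... | true with found
  ...   | refl = cong (λ t → tourLeftOf ctx ++ tourF pre ++ (down , a) ∷ t) (++-assoc (tourF cs) _ (tourRightOf ctx))
               , ≡ᵇ⇒≡ _ _ (Equivalence.from T-≡ a≡e)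
  findF-sound e ctx pre ((a , node cs) ∷ rs) r found | false
    with findF e ((pre , a , rs) ∷ ctx) [] cs in inCs
  ... | just r' with found
  ...   | refl with findF-sound e ((pre , a , rs) ∷ ctx) [] cs r' inCs
  ...     | tour≡ , edge≡ =
    trans (reassociate (tourLeftOf ctx) (tourF pre) [ (down , a) ] (tourF cs) [ (up , a) ] (tourF rs)
                       (tourRightOf ctx))
          tour≡
    , edge≡
    where
    reassociate : (P Q D R Up S U : List (Dart L)) →
      P ++ Q ++ (D ++ R ++ Up ++ S) ++ U ≡ (P ++ Q ++ D) ++ [] ++ R ++ (Up ++ S ++ U)
    reassociate P Q D R Up S U = solve (++-monoid (Dart L))
  findF-sound e ctx pre ((a , node cs) ∷ rs) r found | false | nothing
    with findF-sound e ctx (pre ++ [ (a , node cs) ]) rs r found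
  ... | tour≡ , edge≡ = trans (cong (λ t → tourLeftOf ctx ++ t) tour≡') tour≡ , edge≡
    where
    tour≡' : tourF pre ++ ((down , a) ∷ tourF cs ++ (up , a) ∷ tourF rs) ++ tourRightOf ctx ≡
             tourF (pre ++ [ (a , node cs) ]) ++ tourF rs ++ tourRightOf ctx
    tour≡' rewrite tourF-++ pre [ (a , node cs) ] =
      reassociate (tourF pre) [ (down , a) ] (tourF cs) [ (up , a) ] (tourF rs) (tourRightOf ctx)
      where
      reassociate : (Q D R Up S U : List (Dart L)) →
        Q ++ (D ++ R ++ Up ++ S) ++ U ≡ (Q ++ D ++ R ++ Up ++ []) ++ S ++ U
      reassociate Q D R Up S U = solve (++-monoid (Dart L))

  findF-complete : ∀ e ctx pre (F : Forest (ℕ × L)) → findF e ctx pre F ≡ nothing →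
                   countᵇ (onEdge e) (tourF F) ≡ 0
  findF-complete e ctx pre []                  _ = refl
  findF-complete e ctx pre ((a , node cs) ∷ rs) notFound with proj₁ a ≡ᵇ e in a≢e
  ... | false with findF e ((pre , a , rs) ∷ ctx) [] cs in inCs
  ...   | nothing = begin
    countᵇ (onEdge e) (tourF ((a , node cs) ∷ rs))
      ≡⟨ countᵇ-around-reject (onEdge e) {down , a} {up , a} (tourF cs) (tourF rs) a∉ a∉ ⟩
    countᵇ (onEdge e) (tourF cs) + countᵇ (onEdge e) (tourF rs)
      ≡⟨ cong₂ _+_ (findF-complete e _ [] cs inCs) (findF-complete e ctx _ rs notFound) ⟩
    0 ∎
    where
    open ≡-Reasoning
    a∉ : isEdge e a ≡ false
    a∉ = ≢⇒≡ᵇ≡false e (proj₁ a) λ { refl → case trans (sym (≡ᵇ-refl e)) a≢e of λ () }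

  map-proj₂-tourF-++ : ∀ (F : Forest (ℕ × L)) (ws : List (Dart L)) →
                       map proj₂ (tourF F ++ ws) ≡ edgeTourF F ++ map proj₂ ws
  map-proj₂-tourF-++ F ws = trans (map-++ proj₂ (tourF F) ws) (cong (_++ map proj₂ ws) (map-proj₂-tourF F))

  -- The darts outside the subtree below the frame's edge, in cyclic order after that edge.
  outsideTour : Frame (ℕ × L) → List (Frame (ℕ × L)) → List (Dart L)
  outsideTour (ls , _ , rs) ctx = tourF rs ++ tourRightOf ctx ++ tourLeftOf ctx ++ tourF ls

  edgeTourF-upW : ∀ fr ctx → edgeTourF (upW fr ctx) ≡ map proj₂ (outsideTour fr ctx)
  edgeTourF-upW (ls , _ , rs) [] = begin
    edgeTourF (rs ++ ls)                ≡⟨ edgeTourF-++ rs ls ⟩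
    edgeTourF rs ++ edgeTourF ls        ≡⟨ cong (edgeTourF rs ++_) (map-proj₂-tourF ls) ⟨
    edgeTourF rs ++ map proj₂ (tourF ls) ≡⟨ map-proj₂-tourF-++ rs (tourF ls) ⟨
    map proj₂ (tourF rs ++ tourF ls)    ∎
    where open ≡-Reasoning
  edgeTourF-upW (ls , a , rs) (fr@(ls' , b , rs') ∷ ctx) = begin
    edgeTourF (rs ++ (b , node (upW fr ctx)) ∷ ls)
      ≡⟨ edgeTourF-++ rs _ ⟩
    edgeTourF rs ++ b ∷ edgeTourF (upW fr ctx) ++ b ∷ edgeTourF ls
      ≡⟨ cong₂ (λ u v → edgeTourF rs ++ b ∷ u ++ b ∷ v) (edgeTourF-upW fr ctx) (sym (map-proj₂-tourF ls)) ⟩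
    edgeTourF rs ++ b ∷ map proj₂ (outsideTour fr ctx) ++ map proj₂ ((down , b) ∷ tourF ls)
      ≡⟨ cong (λ t → edgeTourF rs ++ b ∷ t) (map-++ proj₂ (outsideTour fr ctx) ((down , b) ∷ tourF ls)) ⟨
    edgeTourF rs ++ map proj₂ ((up , b) ∷ outsideTour fr ctx ++ (down , b) ∷ tourF ls)
      ≡⟨ map-proj₂-tourF-++ rs _ ⟨
    map proj₂ (tourF rs ++ (up , b) ∷ outsideTour fr ctx ++ (down , b) ∷ tourF ls)
      ≡⟨ cong (map proj₂) (reassociate (tourF rs) [ (up , b) ] (tourF rs') (tourRightOf ctx)
                                       (tourLeftOf ctx) (tourF ls') [ (down , b) ] (tourF ls)) ⟩
    map proj₂ (outsideTour (ls , a , rs) (fr ∷ ctx)) ∎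
    where
    open ≡-Reasoning
    reassociate : (A U B C D E V F : List (Dart L)) →
      A ++ U ++ (B ++ C ++ D ++ E) ++ V ++ F ≡ A ++ (U ++ B ++ C) ++ (D ++ E ++ V) ++ F
    reassociate A U B C D E V F = solve (++-monoid (Dart L))

  edgeTourF-rerootDown : ∀ ctx pre a cs rs → edgeTourF ((a , node cs) ∷ rs ++ parentPart ctx ++ pre) ≡
    map proj₂ ((down , a) ∷ tourF cs ++ (up , a) ∷ outsideTour (pre , a , rs) ctx)
  edgeTourF-rerootDown ctx pre a cs rs = cong (a ∷_) (begin
    edgeTourF cs ++ a ∷ edgeTourF (rs ++ parentPart ctx ++ pre)
      ≡⟨ cong (λ t → edgeTourF cs ++ a ∷ edgeTourF t) (upW-as-++ ctx) ⟩
    edgeTourF cs ++ a ∷ edgeTourF (upW (pre , a , rs) ctx)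
      ≡⟨ cong (λ t → edgeTourF cs ++ a ∷ t) (edgeTourF-upW (pre , a , rs) ctx) ⟩
    edgeTourF cs ++ map proj₂ ((up , a) ∷ outsideTour (pre , a , rs) ctx)
      ≡⟨ map-proj₂-tourF-++ cs _ ⟨
    map proj₂ (tourF cs ++ (up , a) ∷ outsideTour (pre , a , rs) ctx) ∎)
    where
    open ≡-Reasoning
    upW-as-++ : ∀ ctx → rs ++ parentPart ctx ++ pre ≡ upW (pre , a , rs) ctx
    upW-as-++ []      = refl
    upW-as-++ (_ ∷ _) = refl

  edgeTourF-rerootUp : ∀ ctx pre a cs rs → edgeTourF ((a , node (upW (pre , a , rs) ctx)) ∷ cs) ≡
    map proj₂ ((up , a) ∷ outsideTour (pre , a , rs) ctx ++ (down , a) ∷ tourF cs)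
  edgeTourF-rerootUp ctx pre a cs rs = cong (a ∷_) (begin
    edgeTourF (upW (pre , a , rs) ctx) ++ a ∷ edgeTourF cs
      ≡⟨ cong₂ (λ u v → u ++ a ∷ v) (edgeTourF-upW (pre , a , rs) ctx) (sym (map-proj₂-tourF cs)) ⟩
    map proj₂ (outsideTour (pre , a , rs) ctx) ++ map proj₂ ((down , a) ∷ tourF cs)
      ≡⟨ map-++ proj₂ (outsideTour (pre , a , rs) ctx) _ ⟨
    map proj₂ (outsideTour (pre , a , rs) ctx ++ (down , a) ∷ tourF cs) ∎)
    where open ≡-Reasoning

  edgeTourT-reroot : ∀ C (x : Dart L) V₁ V₂ → tourF C ≡ V₁ ++ x ∷ V₂ →
    (∀ e → countᵇ (onEdge e) (tourF C) ≤ 2) →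
    edgeTourT (reroot x (node C)) ≡ map proj₂ (x ∷ V₂ ++ V₁)
  edgeTourT-reroot C x V₁ V₂ tourC twice with findF (edgeOfDart x) [] [] C in found
  ... | nothing = ⊥-elim (countᵇ-++-∷≢0 (onEdge e) V₁ V₂ (≡ᵇ-refl e)
                    (trans (cong (countᵇ (onEdge e)) (sym tourC)) (findF-complete e [] [] C found)))
    where e = edgeOfDart x
  ... | just (ctx , pre , a , node cs , rs) with findF-sound (edgeOfDart x) [] [] C _ found
  ...   | tour≡ , a≡e
    with split-at-pair (onEdge e) V₁ V₂ X₁ M N (trans (sym tourC) tourC≡) (≡ᵇ-refl e) a-on-e a-on-e
           (subst (_≤ 2) (cong (countᵇ (onEdge e)) tourC≡) (twice e))
    where
    e = edgeOfDart x
    X₁ = tourLeftOf ctx ++ tourF pre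
    M  = tourF cs
    N  = tourF rs ++ tourRightOf ctx
    tourC≡ : tourF C ≡ X₁ ++ (down , a) ∷ M ++ (up , a) ∷ N
    tourC≡ = trans (sym (++-identityʳ (tourF C))) (trans tour≡ (sym (++-assoc (tourLeftOf ctx) (tourF pre) _)))
    a-on-e : isEdge e a ≡ true
    a-on-e = subst (λ n → (e ≡ᵇ n) ≡ true) (sym a≡e) (≡ᵇ-refl e)
  ...     | inj₁ (refl , refl , refl) =
    trans (edgeTourF-rerootDown ctx pre a cs rs)
      (cong (λ t → a ∷ map proj₂ t)
        (reassociate (tourF cs) [ (up , a) ] (tourF rs) (tourRightOf ctx) (tourLeftOf ctx) (tourF pre)))
    where
    reassociate : (M U R Rc Lc P : List (Dart L)) → M ++ U ++ R ++ Rc ++ Lc ++ P ≡ (M ++ U ++ R ++ Rc) ++ Lc ++ P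
    reassociate M U R Rc Lc P = solve (++-monoid (Dart L))
  ...     | inj₂ (refl , refl , refl) =
    trans (edgeTourF-rerootUp ctx pre a cs rs)
      (cong (λ t → a ∷ map proj₂ t)
        (reassociate (tourF rs) (tourRightOf ctx) (tourLeftOf ctx) (tourF pre) [ (down , a) ] (tourF cs)))
    where
    reassociate : (R Rc Lc P D M : List (Dart L)) → (R ++ Rc ++ Lc ++ P) ++ D ++ M ≡ (R ++ Rc) ++ (Lc ++ P) ++ D ++ M
    reassociate R Rc Lc P D M = solve (++-monoid (Dart L))


-- Segments

module Segment {L : Set} (q : Forest L) where

  numbered : Forest (ℕ × L)
  numbered = proj₁ (numF 0 q)

  -- walk (node q) is W ++ W by definition.
  W : List (Dart L)
  W = tourF numbered

  W-atMostTwice : ∀ e → countᵇ (onEdge e) W ≤ 2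
  W-atMostTwice = NumberedFrom.atMostTwice (numF-numberedFrom 0 q)

  length-W : length W ≡ sizeF q + sizeF q
  length-W = trans (length-tourF numbered) (cong₂ _+_ (sizeF-numF 0 q) (sizeF-numF 0 q))

  rotation-atMostTwice : ∀ {S} → IsRotationOf S W → ∀ e → countᵇ (onEdge e) S ≤ 2
  rotation-atMostTwice r e = subst (_≤ 2) (sym (rotation-countᵇ (onEdge e) r)) (W-atMostTwice e)

  kept : List (Dart L) → ℕ → Bool
  kept w e = 2 ≤ᵇ count e w

  keptDart : List (Dart L) → Dart L → Bool
  keptDart w = kept w ∘ edgeOfDart

  segmentAt : List (Dart L) → Maybe (Dart L) → Tree (ℕ × L)
  segmentAt w nothing  = node []
  segmentAt w (just x) = reroot x (node (contractF (kept w) numbered))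

  segmentOf : List (Dart L) → Tree (ℕ × L)
  segmentOf w = segmentAt w (firstKept (kept w) w)

  segment≡segmentOf : ∀ l r → segment (node q) l r ≡ mapT proj₂ (segmentOf (window (node q) l r))
  segment≡segmentOf l r with firstKept (kept (window (node q) l r)) (window (node q) l r)
  ... | nothing = refl
  ... | just _  = refl

  edgeTourT-segmentOf : ∀ w {S} → IsRotationOf S W → IsPrefixOf w S →
                        edgeTourT (segmentOf w) ≡ map proj₂ (filterᵇ (keptDart w) S)
  edgeTourT-segmentOf w {S} rot (Z , S≡) with firstKept (kept w) w in found
  ... | nothing = cong (map proj₂) (sym (filterᵇ-all-false (keptDart w) S (none ∘ edgeOfDart)))
    where
    none : ∀ e → kept w e ≡ false
    none e with kept w e in Ke
    ... | false = refl
    ... | true  = ⊥-elim (<⇒≱ (s≤s z≤n) (begin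
      2                       ≤⟨ ≤ᵇ⇒≤ 2 (count e w) (Equivalence.from T-≡ Ke) ⟩
      count e w               ≡⟨ count≡countᵇ e w ⟩
      countᵇ (onEdge e) w     ≡⟨ firstKept-nothing (kept w) w found e Ke ⟩
      0                       ∎))
      where open ≤-Reasoning
  ... | just x with firstKept-just (kept w) w found
  ...   | P , R , refl , Kx , P-dropped with rotation-∷ rot'
    where
    rot' : IsRotationOf (x ∷ (R ++ Z) ++ P) W
    rot' = rotation-move P (R ++ Z) (subst (λ S' → IsRotationOf S' W) (trans S≡ (++-assoc P (x ∷ R) Z)) rot)
  ...     | A , B , W≡ , RZP≡ = trans (edgeTourT-reroot contracted x (filterᵇ k A) (filterᵇ k B) tour twice)
                                      (cong (map proj₂) rest≡)
    where
    k = keptDart w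
    contracted = contractF (kept w) numbered
    tour : tourF contracted ≡ filterᵇ k A ++ x ∷ filterᵇ k B
    tour = begin
      tourF contracted                ≡⟨ tourF-contractF (kept w) numbered ⟩
      filterᵇ k W                     ≡⟨ cong (filterᵇ k) W≡ ⟩
      filterᵇ k (A ++ x ∷ B)          ≡⟨ filter-++ (T? ∘ k) A (x ∷ B) ⟩
      filterᵇ k A ++ filterᵇ k (x ∷ B) ≡⟨ cong (filterᵇ k A ++_) (filterᵇ-accept k B Kx) ⟩
      filterᵇ k A ++ x ∷ filterᵇ k B  ∎
      where open ≡-Reasoning
    twice : ∀ e → countᵇ (onEdge e) (tourF contracted) ≤ 2
    twice e = ≤-trans (≤-reflexive (cong (countᵇ (onEdge e)) (tourF-contractF (kept w) numbered)))
                      (≤-trans (countᵇ-filterᵇ (onEdge e) k W) (W-atMostTwice e))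
    rest≡ : x ∷ filterᵇ k B ++ filterᵇ k A ≡ filterᵇ k S
    rest≡ = sym (begin
      filterᵇ k S                         ≡⟨ cong (filterᵇ k) (trans S≡ (++-assoc P (x ∷ R) Z)) ⟩
      filterᵇ k (P ++ x ∷ R ++ Z)         ≡⟨ filterᵇ-++-comm k P (x ∷ R ++ Z) P-dropped ⟩
      filterᵇ k (x ∷ (R ++ Z) ++ P)       ≡⟨ filterᵇ-accept k ((R ++ Z) ++ P) Kx ⟩
      x ∷ filterᵇ k ((R ++ Z) ++ P)       ≡⟨ cong (λ t → x ∷ filterᵇ k t) RZP≡ ⟩
      x ∷ filterᵇ k (B ++ A)              ≡⟨ cong (x ∷_) (filter-++ (T? ∘ k) B A) ⟩
      x ∷ filterᵇ k B ++ filterᵇ k A      ∎)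
      where open ≡-Reasoning

  segmentOf-atMostTwice : ∀ w {S} → IsRotationOf S W → IsPrefixOf w S → AtMostTwice (edgeTourT (segmentOf w))
  segmentOf-atMostTwice w {S} rot pre e = begin
    countᵇ (isEdge e) (edgeTourT (segmentOf w))                   ≡⟨ cong (countᵇ (isEdge e)) (edgeTourT-segmentOf w rot pre) ⟩
    countᵇ (isEdge e) (map proj₂ (filterᵇ (keptDart w) S))         ≡⟨ countᵇ-map-proj₂ e (filterᵇ (keptDart w) S) ⟩
    countᵇ (onEdge e) (filterᵇ (keptDart w) S)                     ≤⟨ countᵇ-filterᵇ (onEdge e) (keptDart w) S ⟩
    countᵇ (onEdge e) S                                            ≤⟨ rotation-atMostTwice rot e ⟩
    2                                                              ∎
    where open ≤-Reasoning

  kept-extension : ∀ w w' (y : Dart L) → (∀ e → count e w' ≡ countᵇ (onEdge e) [ y ] + count e w) →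
    (∀ e → e ≢ edgeOfDart y → kept w' e ≡ kept w e) ×
    (kept w (edgeOfDart y) ≡ true → kept w' (edgeOfDart y) ≡ true)
  kept-extension w w' y counts = agree , mono
    where
    agree : ∀ e → e ≢ edgeOfDart y → kept w' e ≡ kept w e
    agree e e≢y = cong (2 ≤ᵇ_) (trans (counts e)
      (cong (_+ count e w) (countᵇ-reject (onEdge e) {y} [] (≢⇒≡ᵇ≡false _ _ e≢y))))
    mono : kept w (edgeOfDart y) ≡ true → kept w' (edgeOfDart y) ≡ true
    mono Ky = Equivalence.to T-≡ (≤⇒≤ᵇ (begin
      2                                                     ≤⟨ ≤ᵇ⇒≤ 2 _ (Equivalence.from T-≡ Ky) ⟩
      count (edgeOfDart y) w                                ≤⟨ m≤n+m _ _ ⟩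
      countᵇ (onEdge (edgeOfDart y)) [ y ] + count (edgeOfDart y) w ≡⟨ counts (edgeOfDart y) ⟨
      count (edgeOfDart y) w'                               ∎))
      where open ≤-Reasoning

  segmentOf-extend : ∀ w w' (y : Dart L) {S S₂} →
    (∀ e → count e w' ≡ countᵇ (onEdge e) [ y ] + count e w) →
    IsRotationOf S W → IsPrefixOf w' S → IsRotationOf S₂ W → IsPrefixOf w S₂ →
    filterᵇ (keptDart w) S₂ ≡ filterᵇ (keptDart w) S →
    (Σ (List (Dart L)) λ S₁ → Σ (List (Dart L)) λ S₃ → S ≡ S₁ ++ y ∷ S₃) →
    EqualOrContraction (segmentOf w') (segmentOf w)
  segmentOf-extend w w' y {S} {S₂} counts rot pre rot₂ pre₂ same (S₁ , S₃ , S≡)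
    with agree-or-newly-kept (kept w) (kept w') (edgeOfDart y) (proj₁ ext) (proj₂ ext)
    where ext = kept-extension w w' y counts
  ... | inj₁ agree = inj₁ (edgeTourT-injective _ _ (begin
    edgeTourT (segmentOf w')                  ≡⟨ edgeTourT-segmentOf w' rot pre ⟩
    map proj₂ (filterᵇ (keptDart w') S)       ≡⟨ cong (map proj₂) (filterᵇ-cong S (agree ∘ edgeOfDart)) ⟩
    map proj₂ (filterᵇ (keptDart w) S)        ≡⟨ cong (map proj₂) same ⟨
    map proj₂ (filterᵇ (keptDart w) S₂)       ≡⟨ edgeTourT-segmentOf w rot₂ pre₂ ⟨
    edgeTourT (segmentOf w)                   ∎) (segmentOf-atMostTwice w' rot pre))
    where open ≡-Reasoning
  ... | inj₂ (K'₀ , K₀) =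
    inj₂ (filterᵇ-edgeTourT⇒contraction _ _ e₀ (segmentOf-atMostTwice w' rot pre) occurs (begin
      edgeTourT (segmentOf w)
        ≡⟨ edgeTourT-segmentOf w rot₂ pre₂ ⟩
      map proj₂ (filterᵇ (keptDart w) S₂)
        ≡⟨ cong (map proj₂) same ⟩
      map proj₂ (filterᵇ (keptDart w) S)
        ≡⟨ cong (map proj₂) (filterᵇ-newly-kept (kept w) (kept w') e₀ K'₀ K₀ agree S) ⟩
      map proj₂ (filterᵇ (not ∘ onEdge e₀) (filterᵇ (keptDart w') S))
        ≡⟨ filterᵇ-map (not ∘ isEdge e₀) proj₂ (filterᵇ (keptDart w') S) ⟨
      filterᵇ (not ∘ isEdge e₀) (map proj₂ (filterᵇ (keptDart w') S))
        ≡⟨ cong (filterᵇ (not ∘ isEdge e₀)) (edgeTourT-segmentOf w' rot pre) ⟨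
      filterᵇ (not ∘ isEdge e₀) (edgeTourT (segmentOf w'))
        ∎))
    where
    open ≡-Reasoning
    e₀ = edgeOfDart y
    agree = proj₁ (kept-extension w w' y counts)
    occurs : countᵇ (isEdge e₀) (edgeTourT (segmentOf w')) ≢ 0
    occurs c = countᵇ-++-∷≢0 (onEdge e₀) (filterᵇ k' S₁) (filterᵇ k' S₃) (≡ᵇ-refl e₀) (begin
        countᵇ (onEdge e₀) (filterᵇ k' S₁ ++ y ∷ filterᵇ k' S₃)  ≡⟨ cong (countᵇ (onEdge e₀)) filtered ⟨
        countᵇ (onEdge e₀) (filterᵇ k' S)                        ≡⟨ countᵇ-map-proj₂ e₀ (filterᵇ k' S) ⟨
        countᵇ (isEdge e₀) (map proj₂ (filterᵇ k' S))            ≡⟨ cong (countᵇ (isEdge e₀)) (edgeTourT-segmentOf w' rot pre) ⟨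
        countᵇ (isEdge e₀) (edgeTourT (segmentOf w'))            ≡⟨ c ⟩
        0                                                        ∎)
      where
      k' = keptDart w'
      filtered : filterᵇ k' S ≡ filterᵇ k' S₁ ++ y ∷ filterᵇ k' S₃
      filtered = begin
        filterᵇ k' S                           ≡⟨ cong (filterᵇ k') S≡ ⟩
        filterᵇ k' (S₁ ++ y ∷ S₃)              ≡⟨ filter-++ (T? ∘ k') S₁ (y ∷ S₃) ⟩
        filterᵇ k' S₁ ++ filterᵇ k' (y ∷ S₃)   ≡⟨ cong (filterᵇ k' S₁ ++_) (filterᵇ-accept k' S₃ K'₀) ⟩
        filterᵇ k' S₁ ++ y ∷ filterᵇ k' S₃     ∎

  count-∷ʳ : ∀ e w (y : Dart L) → count e (w ++ [ y ]) ≡ countᵇ (onEdge e) [ y ] + count e w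
  count-∷ʳ e w y = begin
    count e (w ++ [ y ])                            ≡⟨ count≡countᵇ e (w ++ [ y ]) ⟩
    countᵇ (onEdge e) (w ++ [ y ])                  ≡⟨ countᵇ-++ (onEdge e) w [ y ] ⟩
    countᵇ (onEdge e) w + countᵇ (onEdge e) [ y ]   ≡⟨ +-comm (countᵇ (onEdge e) w) _ ⟩
    countᵇ (onEdge e) [ y ] + countᵇ (onEdge e) w   ≡⟨ cong (_ +_) (count≡countᵇ e w) ⟨
    countᵇ (onEdge e) [ y ] + count e w             ∎
    where open ≡-Reasoning

  count-∷ : ∀ e w (y : Dart L) → count e (y ∷ w) ≡ countᵇ (onEdge e) [ y ] + count e w
  count-∷ e w y = begin
    count e (y ∷ w)                                 ≡⟨ count≡countᵇ e (y ∷ w) ⟩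
    countᵇ (onEdge e) ([ y ] ++ w)                  ≡⟨ countᵇ-++ (onEdge e) [ y ] w ⟩
    countᵇ (onEdge e) [ y ] + countᵇ (onEdge e) w   ≡⟨ cong (_ +_) (count≡countᵇ e w) ⟨
    countᵇ (onEdge e) [ y ] + count e w             ∎
    where open ≡-Reasoning

  segmentOf-take-suc : ∀ k m → suc m ≤ length W →
    EqualOrContraction (segmentOf (take (suc m) (drop k (W ++ W)))) (segmentOf (take m (drop k (W ++ W))))
  segmentOf-take-suc k m m<N with window-isPrefixOf-rotation W k (suc m) m<N | take-suc m (drop k (W ++ W))
  ... | _ | inj₁ same-window = inj₁ (cong segmentOf same-window)
  ... | S , rot , Z , S≡ | inj₂ (y , w'≡) =
    subst (λ w' → EqualOrContraction (segmentOf w') (segmentOf w)) (sym w'≡)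
      (segmentOf-extend w (w ++ [ y ]) y (λ e → count-∷ʳ e w y)
        rot (Z , S≡w∷ʳy) rot (y ∷ Z , S≡w∷y) refl (w , Z , S≡w∷y))
    where
    w = take m (drop k (W ++ W))
    S≡w∷ʳy : S ≡ (w ++ [ y ]) ++ Z
    S≡w∷ʳy = trans S≡ (cong (_++ Z) w'≡)
    S≡w∷y : S ≡ w ++ y ∷ Z
    S≡w∷y = trans S≡w∷ʳy (++-assoc w [ y ] Z)

  -- An edge has only two darts, so it cannot be kept in w and occur once more in front of w.
  kept-head≡false : ∀ {S} (y : Dart L) w Z → IsRotationOf S W → S ≡ y ∷ w ++ Z → kept w (edgeOfDart y) ≡ false
  kept-head≡false {S} y w Z rot S≡ with kept w (edgeOfDart y) in Kw
  ... | false = refl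
  ... | true  = ⊥-elim (<⇒≱ thrice (rotation-atMostTwice rot e₀))
    where
    e₀ = edgeOfDart y
    thrice : 2 < countᵇ (onEdge e₀) S
    thrice = begin-strict
      2                                               ≤⟨ ≤ᵇ⇒≤ 2 (count e₀ w) (Equivalence.from T-≡ Kw) ⟩
      count e₀ w                                      ≡⟨ count≡countᵇ e₀ w ⟩
      countᵇ (onEdge e₀) w                            ≤⟨ m≤m+n _ _ ⟩
      countᵇ (onEdge e₀) w + countᵇ (onEdge e₀) Z     ≡⟨ countᵇ-++ (onEdge e₀) w Z ⟨
      countᵇ (onEdge e₀) (w ++ Z)                     <⟨ n<1+n _ ⟩
      suc (countᵇ (onEdge e₀) (w ++ Z))               ≡⟨ countᵇ-accept (onEdge e₀) {y} (w ++ Z) (≡ᵇ-refl e₀) ⟨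
      countᵇ (onEdge e₀) (y ∷ w ++ Z)                 ≡⟨ cong (countᵇ (onEdge e₀)) S≡ ⟨
      countᵇ (onEdge e₀) S                            ∎
      where open ≤-Reasoning

  segmentOf-drop-suc : ∀ k m → suc m ≤ length W →
    EqualOrContraction (segmentOf (take (suc m) (drop k (W ++ W)))) (segmentOf (take m (drop (suc k) (W ++ W))))
  segmentOf-drop-suc k m m<N with window-isPrefixOf-rotation W k (suc m) m<N | drop-suc k (W ++ W)
  ... | _ | inj₁ (dropped , dropped-suc) =
    inj₁ (cong segmentOf (trans (cong (take (suc m)) dropped)
                                (sym (trans (cong (take m) dropped-suc) (take-[] m)))))
  ... | S , rot , Z , S≡ | inj₂ (y , drop≡) =
    subst (λ w' → EqualOrContraction (segmentOf w') (segmentOf w)) (sym w'≡)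
      (segmentOf-extend w (y ∷ w) y (λ e → count-∷ e w y)
        rot (Z , S≡y∷w) (rotation-∷ʳ (subst (λ S' → IsRotationOf S' W) S≡y∷w rot)) (Z ++ [ y ] , ++-assoc w Z [ y ])
        same ([] , w ++ Z , S≡y∷w))
    where
    w = take m (drop (suc k) (W ++ W))
    w'≡ : take (suc m) (drop k (W ++ W)) ≡ y ∷ w
    w'≡ = cong (take (suc m)) drop≡
    S≡y∷w : S ≡ y ∷ w ++ Z
    S≡y∷w = trans S≡ (cong (_++ Z) w'≡)
    y-dropped : keptDart w y ≡ false
    y-dropped = kept-head≡false y w Z rot S≡y∷w
    kw = keptDart w
    same : filterᵇ kw ((w ++ Z) ++ [ y ]) ≡ filterᵇ kw S
    same = begin
      filterᵇ kw ((w ++ Z) ++ [ y ])          ≡⟨ filter-++ (T? ∘ kw) (w ++ Z) [ y ] ⟩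
      filterᵇ kw (w ++ Z) ++ filterᵇ kw [ y ]  ≡⟨ cong (filterᵇ kw (w ++ Z) ++_) (filterᵇ-reject kw [] y-dropped) ⟩
      filterᵇ kw (w ++ Z) ++ []               ≡⟨ ++-identityʳ _ ⟩
      filterᵇ kw (w ++ Z)                     ≡⟨ filterᵇ-reject kw (w ++ Z) y-dropped ⟨
      filterᵇ kw (y ∷ w ++ Z)                 ≡⟨ cong (filterᵇ kw) S≡y∷w ⟨
      filterᵇ kw S                            ∎
      where open ≡-Reasoning

  suc[j∸i]≤length-W : ∀ {i} j → i ≤ j → (j + 1) ∸ i ≤ 2 * sizeF q → suc (j ∸ i) ≤ length W
  suc[j∸i]≤length-W j i≤j bound = subst₂ _≤_ ([m+1]∸n≡1+[m∸n] j i≤j)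
    (trans (cong (sizeF q +_) (+-identityʳ (sizeF q))) (sym length-W)) bound

  sim-segment-extend-right : ∀ (T : Tree L) i j → i ≤ j → (j + 1) ∸ i ≤ 2 * sizeF q → ∀ {s s'} →
    IsSim T (segment (node q) i (j + 1)) s → IsSim T (segment (node q) i j) s' → s ≤ s' + 2
  sim-segment-extend-right T i j i≤j bound {s} {s'} sim₁ sim₂ =
    sim-≡⊎contraction proj₂ (segmentOf-take-suc (i ∸ 1) (j ∸ i) (suc[j∸i]≤length-W j i≤j bound))
      (subst (λ t → IsSim T t s) (trans (segment≡segmentOf i (j + 1))
        (cong (λ n → mapT proj₂ (segmentOf (take n (drop (i ∸ 1) (W ++ W))))) ([m+1]∸n≡1+[m∸n] j i≤j))) sim₁)
      (subst (λ t → IsSim T t s') (segment≡segmentOf i j) sim₂)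

  sim-segment-extend-left : ∀ (T : Tree L) i j → 2 ≤ i → i ≤ j → (j + 1) ∸ i ≤ 2 * sizeF q → ∀ {s s'} →
    IsSim T (segment (node q) (i ∸ 1) j) s → IsSim T (segment (node q) i j) s' → s ≤ s' + 2
  sim-segment-extend-left T i@(suc (suc i₀)) j (s≤s (s≤s z≤n)) i≤j bound {s} {s'} sim₁ sim₂ =
    sim-≡⊎contraction proj₂ (segmentOf-drop-suc i₀ (j ∸ i) (suc[j∸i]≤length-W j i≤j bound))
      (subst (λ t → IsSim T t s) (trans (segment≡segmentOf (suc i₀) j)
        (cong (λ n → mapT proj₂ (segmentOf (take n (drop i₀ (W ++ W))))) (m<n⇒n∸m≡1+[n∸1+m] i≤j))) sim₁)
      (subst (λ t → IsSim T t s') (segment≡segmentOf i j) sim₂)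

lemma12 : {L : Set} (T Q : Tree L) →
    (∀ (i j : ℕ) → 1 ≤ i → i ≤ j → (j + 1) ∸ i ≤ 2 * size Q → j + 1 ≤ 4 * size Q →
      ∀ (s s' : ℕ) → IsSim T (segment Q i (j + 1)) s → IsSim T (segment Q i j) s' →
      s ≤ s' + 2)
    ×
    (∀ (i j : ℕ) → 2 ≤ i → i ≤ j → (j + 1) ∸ i ≤ 2 * size Q → j ≤ 4 * size Q →
      ∀ (s s' : ℕ) → IsSim T (segment Q (i ∸ 1) j) s → IsSim T (segment Q i j) s' →
      s ≤ s' + 2)
lemma12 T (node q) =
  (λ i j _ i≤j bound _ _ _ → sim-segment-extend-right T i j i≤j bound) ,
  (λ i j 2≤i i≤j bound _ _ _ → sim-segment-extend-left T i j 2≤i i≤j bound)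
  where open Segment q
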